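{- Suppose that every finite simple graph that contains no triangle, no ISK4 and no $K_{3,3}$ (as induced subgraphs) has a vertex of degree at most $2$. Then every finite simple graph that contains no triangle and no ISK4 is $3$-colorable.
   Context: $G$ contains $H$ if $H$ is isomorphic to an induced subgraph of $G$. A subdivision of a graph is obtained by repeatedly replacing an edge $vw$ by a path $vuw$ through a new vertex $u$. An ISK4 of $G$ is an induced subgraph of $G$ that is a subdivision of $K_4$. $K_{3,3}$ is the complete bipartite graph with both sides of size 3. -}

module Defs where

open import Data.Nat using (ℕ; zero; suc; _<?_)
open import Data.Fin using (Fin; zero; suc; toℕ; _≟_)
open import Data.Bool using (Bool; true; false; _∧_; _∨_; not; _xor_; if_then_else_)
open import Data.List using (map; allFin)
open import Data.Nat.ListAction using (sum)
open import Data.Product using (Σ; _×_; ∃; ∃-syntax; _,_)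
open import Relation.Nullary using (¬_)
open import Relation.Nullary.Decidable using (⌊_⌋)
open import Relation.Binary.PropositionalEquality using (_≡_; refl; cong)
open import Function.Bundles using (_↔_; Inverse)
open import Function.Definitions using (Injective)

record Graph : Set where
  field
    size   : ℕ
    adj    : Fin size → Fin size → Bool
    sym    : ∀ u v → adj u v ≡ adj v u
    irrefl : ∀ v → adj v v ≡ false
open Graph public

degree : (G : Graph) → Fin (size G) → ℕ
degree G u = sum (map (λ v → if adj G u v then 1 else 0) (allFin (size G)))

Iso : Graph → Graph → Set
Iso G H = Σ (Fin (size G) ↔ Fin (size H)) λ f →
  ∀ u v → adj H (Inverse.to f u) (Inverse.to f v) ≡ adj G u v

Contains : Graph → Graph → Set
Contains G H = Σ (Fin (size H) → Fin (size G)) λ f →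
  Injective _≡_ _≡_ f × (∀ u v → adj G (f u) (f v) ≡ adj H u v)

K : ℕ → Graph
K n = record
  { size = n
  ; adj = λ i j → not ⌊ i ≟ j ⌋
  ; sym = symK
  ; irrefl = irrK }
  where
  symK : ∀ (i j : Fin n) → not ⌊ i ≟ j ⌋ ≡ not ⌊ j ≟ i ⌋
  symK i j with i ≟ j | j ≟ i
  ... | Relation.Nullary.yes _ | Relation.Nullary.yes _ = refl
  ... | Relation.Nullary.no _ | Relation.Nullary.no _ = refl
  ... | Relation.Nullary.yes p | Relation.Nullary.no q = Data.Empty.⊥-elim (q (Relation.Binary.PropositionalEquality.sym p))
    where import Data.Empty
  ... | Relation.Nullary.no q | Relation.Nullary.yes p = Data.Empty.⊥-elim (q (Relation.Binary.PropositionalEquality.sym p))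
    where import Data.Empty
  irrK : ∀ (i : Fin n) → not ⌊ i ≟ i ⌋ ≡ false
  irrK i with i ≟ i
  ... | Relation.Nullary.yes _ = refl
  ... | Relation.Nullary.no q = Data.Empty.⊥-elim (q refl)
    where import Data.Empty

Triangle : Graph
Triangle = K 3

K33 : Graph
K33 = record
  { size = 6
  ; adj = λ i j → side i xor side j
  ; sym = λ i j → xor-comm (side i) (side j)
  ; irrefl = λ i → xor-self (side i) }
  where
  side : Fin 6 → Bool
  side i = ⌊ toℕ i <? 3 ⌋
  xor-comm : ∀ a b → (a xor b) ≡ (b xor a)
  xor-comm false false = refl
  xor-comm false true = refl
  xor-comm true false = refl
  xor-comm true true = refl
  xor-self : ∀ a → (a xor a) ≡ false
  xor-self false = refl
  xor-self true = refl

-- Subdividing the edge vw of G: new vertex zero, old vertex i becomes suc i;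
-- the edge vw is removed and zero is joined to v and w.
private
  pair-sym : ∀ a b c d → ((a ∧ b) ∨ (c ∧ d)) ≡ ((d ∧ c) ∨ (b ∧ a))
  pair-sym false false false false = refl
  pair-sym false false false true = refl
  pair-sym false false true false = refl
  pair-sym false false true true = refl
  pair-sym false true false false = refl
  pair-sym false true false true = refl
  pair-sym false true true false = refl
  pair-sym false true true true = refl
  pair-sym true false false false = refl
  pair-sym true false false true = refl
  pair-sym true false true false = refl
  pair-sym true false true true = refl
  pair-sym true true false false = refl
  pair-sym true true false true = refl
  pair-sym true true true false = refl
  pair-sym true true true true = refl

subdivide : (G : Graph) (v w : Fin (size G)) → adj G v w ≡ true → Graph
subdivide G v w _ = record
  { size = suc (size G)
  ; adj = adjS
  ; sym = symS
  ; irrefl = irrS }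
  where
  isVW : Fin (size G) → Bool
  isVW i = ⌊ i ≟ v ⌋ ∨ ⌊ i ≟ w ⌋
  isPair : Fin (size G) → Fin (size G) → Bool
  isPair i j = (⌊ i ≟ v ⌋ ∧ ⌊ j ≟ w ⌋) ∨ (⌊ i ≟ w ⌋ ∧ ⌊ j ≟ v ⌋)
  adjS : Fin (suc (size G)) → Fin (suc (size G)) → Bool
  adjS zero zero = false
  adjS zero (suc i) = isVW i
  adjS (suc i) zero = isVW i
  adjS (suc i) (suc j) = adj G i j ∧ not (isPair i j)
  symS : ∀ a b → adjS a b ≡ adjS b a
  symS zero zero = refl
  symS zero (suc i) = refl
  symS (suc i) zero = refl
  symS (suc i) (suc j)
    rewrite Graph.sym G i j
          | pair-sym ⌊ i ≟ v ⌋ ⌊ j ≟ w ⌋ ⌊ i ≟ w ⌋ ⌊ j ≟ v ⌋ = refl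
  irrS : ∀ a → adjS a a ≡ false
  irrS zero = refl
  irrS (suc i) rewrite Graph.irrefl G i = refl

data IsSubdivisionOfK4 : Graph → Set where
  base : ∀ {H} → Iso (K 4) H → IsSubdivisionOfK4 H
  step : ∀ {G H} → IsSubdivisionOfK4 G →
         (v w : Fin (size G)) (e : adj G v w ≡ true) →
         Iso (subdivide G v w e) H → IsSubdivisionOfK4 H

ContainsISK4 : Graph → Set
ContainsISK4 G = ∃[ H ] (IsSubdivisionOfK4 H × Contains G H)

ThreeColorable : Graph → Set
ThreeColorable G = Σ (Fin (size G) → Fin 3) λ c →
  ∀ u v → adj G u v ≡ true → ¬ (c u ≡ c v)

-- Induction on the number of vertices. A vertex of degree at most 2 is deleted and coloured
-- last. Otherwise, by hypothesis, G contains an induced K_{3,3}, which we grow to a maximal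
-- induced complete bipartite subgraph K with sides A and B. Maximality, together with the
-- absence of triangles and ISK4s, forces every vertex outside K to have at most one neighbour
-- in K, and more generally forbids any path outside K joining neighbours of two non-adjacent
-- vertices p, q of K: a shortest such path, with a third vertex of A and two vertices of B,
-- would be a subdivision of K4. Hence if K does not span G, the set S of attachments of a
-- component X of G − K is a clique, so |S| ≤ 2; colouring X ∪ S and G − X by induction and
-- permuting colours to agree on S colours G. If K spans G, G is bipartite.

module Submission where

open import Defs
open import Data.Bool using (Bool; true; false; _∧_; _∨_; not; if_then_else_; T)
import Data.Bool.Properties as BP
open import Data.Empty using (⊥; ⊥-elim)
open import Data.Fin using (Fin; zero; suc; toℕ; _≟_)
import Data.Fin.Properties as FP
open import Data.List using (map; tabulate)
open import Data.Nat using (ℕ; zero; suc; _+_; _∸_; _≤_; _<_; _≥_; z≤n; s≤s; _≡ᵇ_; _≤?_; _<?_)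
import Data.Nat.Properties as NP
open import Data.Nat.Properties using (≤-refl; ≤-trans; m≤n⇒m≤1+n)
open import Data.Nat.ListAction using (sum)
open import Data.Product using (Σ; _×_; _,_; proj₁; proj₂; ∃-syntax)
open import Data.Sum using (_⊎_; inj₁; inj₂)
import Data.Sum as Sum
open import Function using (_∘_; id)
open import Function.Construct.Identity using (↔-id)
open import Axiom.UniquenessOfIdentityProofs.WithK using (uip)
open import Relation.Binary.Definitions using (tri<; tri≈; tri>)
open import Relation.Binary.PropositionalEquality using (_≡_; refl; trans; cong; cong₂; subst; subst₂)
  renaming (sym to ≡sym)
open import Relation.Nullary using (¬_; Dec; yes; no)
open import Relation.Nullary.Decidable using (⌊_⌋; from-yes; _×-dec_; _⊎-dec_; _→-dec_; ¬?)

true⇒¬false : ∀ {b} → b ≡ true → b ≡ false → ⊥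
true⇒¬false refl ()

∨-introˡ : ∀ {b} c → b ≡ true → (b ∨ c) ≡ true
∨-introˡ c refl = refl

∨-introʳ : ∀ b {c} → c ≡ true → (b ∨ c) ≡ true
∨-introʳ true refl = refl
∨-introʳ false refl = refl

∨-elim : ∀ b c → (b ∨ c) ≡ true → b ≡ true ⊎ c ≡ true
∨-elim true c _ = inj₁ refl
∨-elim false c p = inj₂ p

∨-false⁻ : ∀ b c → (b ∨ c) ≡ false → b ≡ false × c ≡ false
∨-false⁻ false false _ = refl , refl

∨-false : ∀ {b c} → b ≡ false → c ≡ false → (b ∨ c) ≡ false
∨-false refl refl = refl

⌊⌋⇒ : ∀ {P : Set} (d : Dec P) → ⌊ d ⌋ ≡ true → P
⌊⌋⇒ (yes p) _ = p

⇒⌊⌋ : ∀ {P : Set} (d : Dec P) → P → ⌊ d ⌋ ≡ true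
⇒⌊⌋ (yes p) _ = refl
⇒⌊⌋ (no n) p = ⊥-elim (n p)

⌊≟⌋-refl : ∀ {n} (x : Fin n) → ⌊ x ≟ x ⌋ ≡ true
⌊≟⌋-refl x = ⇒⌊⌋ (x ≟ x) refl

⌊≟⌋⇒≡ : ∀ {n} {w v : Fin n} → ⌊ w ≟ v ⌋ ≡ true → w ≡ v
⌊≟⌋⇒≡ {w = w} {v} = ⌊⌋⇒ (w ≟ v)

T⇒≡true : ∀ {b} → T b → b ≡ true
T⇒≡true {true} _ = refl

≡ᵇ-refl : ∀ n → (n ≡ᵇ n) ≡ true
≡ᵇ-refl n = T⇒≡true (NP.≡⇒≡ᵇ n n refl)

≢⇒≡ᵇ-false : ∀ m n → ¬ m ≡ n → (m ≡ᵇ n) ≡ false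
≢⇒≡ᵇ-false m n m≢n = BP.¬-not (λ e → m≢n (NP.≡ᵇ⇒≡ m n (subst T (≡sym e) _)))

⌊≟⌋≡≡ᵇ : ∀ {n} (i j : Fin n) → ⌊ i ≟ j ⌋ ≡ (toℕ i ≡ᵇ toℕ j)
⌊≟⌋≡≡ᵇ i j with i ≟ j
... | yes refl = ≡sym (≡ᵇ-refl (toℕ i))
... | no i≢j = ≡sym (≢⇒≡ᵇ-false (toℕ i) (toℕ j) (i≢j ∘ FP.toℕ-injective))

Vertex : Graph → Set
Vertex G = Fin (size G)

count : ∀ {n} → (Fin n → Bool) → ℕ
count {zero} f = 0
count {suc n} f = (if f zero then 1 else 0) + count (f ∘ suc)

sum-indicator-tabulate : ∀ {m n} (f : Fin m → Bool) (t : Fin n → Fin m) →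
  sum (map (λ v → if f v then 1 else 0) (tabulate t)) ≡ count (f ∘ t)
sum-indicator-tabulate {n = zero} f t = refl
sum-indicator-tabulate {n = suc n} f t =
  cong ((if f (t zero) then 1 else 0) +_) (sum-indicator-tabulate f (t ∘ suc))

degree≡count : (G : Graph) (u : Vertex G) → degree G u ≡ count (adj G u)
degree≡count G u = sum-indicator-tabulate (adj G u) id

count-cong : ∀ {n} (f g : Fin n → Bool) → (∀ i → f i ≡ g i) → count f ≡ count g
count-cong {zero} f g h = refl
count-cong {suc n} f g h rewrite h zero = cong (_ +_) (count-cong _ _ (h ∘ suc))

count-mono : ∀ {n} (f g : Fin n → Bool) → (∀ i → f i ≡ true → g i ≡ true) → count f ≤ count g
count-mono {zero} f g h = z≤n
count-mono {suc n} f g h with f zero in e1 | g zero in e2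
... | true | true = s≤s (count-mono _ _ (h ∘ suc))
... | true | false with () ← trans (≡sym e2) (h zero e1)
... | false | true = m≤n⇒m≤1+n (count-mono _ _ (h ∘ suc))
... | false | false = count-mono _ _ (h ∘ suc)

count-mono-< : ∀ {n} (f g : Fin n → Bool) → (∀ i → f i ≡ true → g i ≡ true) →
  (v : Fin n) → f v ≡ false → g v ≡ true → count f < count g
count-mono-< {suc n} f g h zero fv gv rewrite fv | gv = s≤s (count-mono _ _ (h ∘ suc))
count-mono-< {suc n} f g h (suc v) fv gv with f zero in e1 | g zero in e2
... | true | true = s≤s (count-mono-< _ _ (h ∘ suc) v fv gv)
... | true | false with () ← trans (≡sym e2) (h zero e1)
... | false | true = m≤n⇒m≤1+n (count-mono-< _ _ (h ∘ suc) v fv gv)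
... | false | false = count-mono-< _ _ (h ∘ suc) v fv gv

count-¬∪-< : ∀ {n} (f : Fin n → Bool) (w : Fin n) → f w ≡ false →
             count (λ z → not (f z ∨ ⌊ z ≟ w ⌋)) < count (not ∘ f)
count-¬∪-< f w fw = count-mono-< _ _ shrinks w w-added (cong not fw)
  where
  shrinks : ∀ z → not (f z ∨ ⌊ z ≟ w ⌋) ≡ true → not (f z) ≡ true
  shrinks z h with f z
  ... | false = refl
  ... | true = h
  w-added : not (f w ∨ ⌊ w ≟ w ⌋) ≡ false
  w-added rewrite ⌊≟⌋-refl w = cong not (BP.∨-zeroʳ (f w))

_∖_ : ∀ {n} → (Fin n → Bool) → Fin n → Fin n → Bool
(f ∖ v) i = f i ∧ not ⌊ i ≟ v ⌋

∖-true : ∀ {n} (f : Fin n → Bool) {u v : Fin n} → f u ≡ true → ¬ u ≡ v → (f ∖ v) u ≡ true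
∖-true f {u} {v} fu u≢v with u ≟ v
... | yes u≡v = ⊥-elim (u≢v u≡v)
... | no _ rewrite fu = refl

count-∖ : ∀ {n} (f : Fin n → Bool) (v : Fin n) → f v ≡ true → count (f ∖ v) < count f
count-∖ f v fv = count-mono-< (f ∖ v) f ∖⇒f v v∉ fv
  where
  ∖⇒f : ∀ i → (f ∖ v) i ≡ true → f i ≡ true
  ∖⇒f i p with f i
  ... | true = refl
  ... | false = p
  v∉ : (f ∖ v) v ≡ false
  v∉ rewrite ⌊≟⌋-refl v = BP.∧-zeroʳ (f v)

count≥3 : ∀ {n} (f : Fin n → Bool) (u v w : Fin n) → ¬ u ≡ v → ¬ u ≡ w → ¬ v ≡ w →
          f u ≡ true → f v ≡ true → f w ≡ true → 3 ≤ count f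
count≥3 f u v w u≢v u≢w v≢w fu fv fw =
  ≤-trans (s≤s (≤-trans (s≤s (≤-trans (s≤s z≤n) (count-∖ ((f ∖ w) ∖ v) u fwvu)))
                                     (count-∖ (f ∖ w) v (∖-true f fv v≢w))))
          (count-∖ f w fw)
  where
  fwvu : ((f ∖ w) ∖ v) u ≡ true
  fwvu = ∖-true (f ∖ w) (∖-true f fu u≢w) u≢v

record Selection (n : ℕ) (P : Fin n → Bool) : Set where
  field
    card            : ℕ
    embed           : Fin card → Fin n
    embed-injective : ∀ {i j} → embed i ≡ embed j → i ≡ j
    preimage        : ∀ v → P v ≡ true → Fin card
    embed-preimage  : ∀ v p → embed (preimage v p) ≡ v
    card≤           : card ≤ n
    card<           : ∀ v → P v ≡ false → card < n

select : ∀ n (P : Fin n → Bool) → Selection n P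
select zero P = record
  { card = 0 ; embed = λ () ; embed-injective = λ {i} → λ {} ; preimage = λ ()
  ; embed-preimage = λ () ; card≤ = z≤n ; card< = λ () }
select (suc n) P with select n (P ∘ suc) | P zero in P0
... | S | true = record
  { card = suc card ; embed = embed′ ; embed-injective = injective′ ; preimage = preimage′
  ; embed-preimage = embed-preimage′ ; card≤ = s≤s card≤ ; card< = card<′ }
  where
  open Selection S
  embed′ : Fin (suc card) → Fin (suc n)
  embed′ zero = zero
  embed′ (suc i) = suc (embed i)
  injective′ : ∀ {i j} → embed′ i ≡ embed′ j → i ≡ j
  injective′ {zero} {zero} p = refl
  injective′ {suc i} {suc j} p = cong suc (embed-injective (FP.suc-injective p))
  preimage′ : ∀ v → P v ≡ true → Fin (suc card)
  preimage′ zero _ = zero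
  preimage′ (suc v) p = suc (preimage v p)
  embed-preimage′ : ∀ v p → embed′ (preimage′ v p) ≡ v
  embed-preimage′ zero p = refl
  embed-preimage′ (suc v) p = cong suc (embed-preimage v p)
  card<′ : ∀ v → P v ≡ false → suc card < suc n
  card<′ zero p with () ← trans (≡sym P0) p
  card<′ (suc v) p = s≤s (card< v p)
... | S | false = record
  { card = card ; embed = suc ∘ embed ; embed-injective = embed-injective ∘ FP.suc-injective
  ; preimage = preimage′ ; embed-preimage = embed-preimage′ ; card≤ = m≤n⇒m≤1+n card≤
  ; card< = λ _ _ → s≤s card≤ }
  where
  open Selection S
  preimage′ : ∀ v → P v ≡ true → Fin card
  preimage′ zero p with () ← trans (≡sym P0) p
  preimage′ (suc v) p = preimage v p
  embed-preimage′ : ∀ v p → suc (embed (preimage′ v p)) ≡ v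
  embed-preimage′ zero p with () ← trans (≡sym P0) p
  embed-preimage′ (suc v) p = cong suc (embed-preimage v p)

induced : (G : Graph) (P : Vertex G → Bool) → Graph
induced G P = record
  { size = card ; adj = λ i j → adj G (embed i) (embed j)
  ; sym = λ i j → Graph.sym G _ _ ; irrefl = λ i → Graph.irrefl G _ }
  where open Selection (select (size G) P)

induced-smaller : (G : Graph) (P : Vertex G → Bool) (v : Vertex G) → P v ≡ false →
                  size (induced G P) < size G
induced-smaller G P = Selection.card< (select (size G) P)

contains-induced : (G : Graph) (P : Vertex G → Bool) → Contains G (induced G P)
contains-induced G P = embed , embed-injective , λ u v → refl
  where open Selection (select (size G) P)

Contains-trans : ∀ {G H K} → Contains G H → Contains H K → Contains G K
Contains-trans (f , f-inj , f-adj) (g , g-inj , g-adj) =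
  f ∘ g , g-inj ∘ f-inj , λ u v → trans (f-adj (g u) (g v)) (g-adj u v)

TriangleFree : Graph → Set
TriangleFree G = ¬ Contains G Triangle

ISK4Free : Graph → Set
ISK4Free G = ¬ ContainsISK4 G

TriangleFree-induced : ∀ G P → TriangleFree G → TriangleFree (induced G P)
TriangleFree-induced G P tfG t = tfG (Contains-trans {G} {induced G P} {Triangle} (contains-induced G P) t)

ISK4Free-induced : ∀ G P → ISK4Free G → ISK4Free (induced G P)
ISK4Free-induced G P ifG (H , isk4 , c) = ifG (H , isk4 , Contains-trans {G} {induced G P} {H} (contains-induced G P) c)

adj⇒≢ : (G : Graph) {x y : Vertex G} → adj G x y ≡ true → ¬ x ≡ y
adj⇒≢ G {x} e refl with () ← trans (≡sym e) (Graph.irrefl G x)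

adj-sym : (G : Graph) {x y : Vertex G} → adj G x y ≡ true → adj G y x ≡ true
adj-sym G {x} {y} e = trans (Graph.sym G y x) e

triangle : (G : Graph) (x y z : Vertex G) →
           adj G x y ≡ true → adj G y z ≡ true → adj G x z ≡ true → Contains G Triangle
triangle G x y z xy yz xz = f , (λ {i} {j} → f-injective i j) , f-adj
  where
  f : Fin 3 → Vertex G
  f zero = x
  f (suc zero) = y
  f (suc (suc zero)) = z
  f-injective : ∀ i j → f i ≡ f j → i ≡ j
  f-injective zero zero p = refl
  f-injective zero (suc zero) p = ⊥-elim (adj⇒≢ G xy p)
  f-injective zero (suc (suc zero)) p = ⊥-elim (adj⇒≢ G xz p)
  f-injective (suc zero) zero p = ⊥-elim (adj⇒≢ G (adj-sym G xy) p)
  f-injective (suc zero) (suc zero) p = refl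
  f-injective (suc zero) (suc (suc zero)) p = ⊥-elim (adj⇒≢ G yz p)
  f-injective (suc (suc zero)) zero p = ⊥-elim (adj⇒≢ G (adj-sym G xz) p)
  f-injective (suc (suc zero)) (suc zero) p = ⊥-elim (adj⇒≢ G (adj-sym G yz) p)
  f-injective (suc (suc zero)) (suc (suc zero)) p = refl
  f-adj : ∀ u v → adj G (f u) (f v) ≡ adj Triangle u v
  f-adj zero zero = Graph.irrefl G x
  f-adj zero (suc zero) = xy
  f-adj zero (suc (suc zero)) = xz
  f-adj (suc zero) zero = adj-sym G xy
  f-adj (suc zero) (suc zero) = Graph.irrefl G y
  f-adj (suc zero) (suc (suc zero)) = yz
  f-adj (suc (suc zero)) zero = adj-sym G xz
  f-adj (suc (suc zero)) (suc zero) = adj-sym G yz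
  f-adj (suc (suc zero)) (suc (suc zero)) = Graph.irrefl G z

ProperOn : (G : Graph) → (Vertex G → Bool) → (Vertex G → Fin 3) → Set
ProperOn G P c = ∀ u v → P u ≡ true → P v ≡ true → adj G u v ≡ true → ¬ c u ≡ c v

lift-colouring : (G : Graph) (P : Vertex G → Bool) → ThreeColorable (induced G P) →
                 Σ (Vertex G → Fin 3) (ProperOn G P)
lift-colouring G P (c′ , c′-proper) = c , c-proper
  where
  open Selection (select (size G) P)
  colourAt : ∀ v b → P v ≡ b → Fin 3
  colourAt v true p = c′ (preimage v p)
  colourAt v false _ = zero
  c : Vertex G → Fin 3
  c v = colourAt v (P v) refl
  c≡c′ : ∀ v {b} (e : P v ≡ b) (p : P v ≡ true) → colourAt v b e ≡ c′ (preimage v p)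
  c≡c′ v {true} e p = cong (c′ ∘ preimage v) (uip e p)
  c≡c′ v {false} e p with () ← trans (≡sym e) p
  c-proper : ProperOn G P c
  c-proper u v pu pv uv eq = c′-proper (preimage u pu) (preimage v pv)
    (subst₂ (λ x y → adj G x y ≡ true) (≡sym (embed-preimage u pu)) (≡sym (embed-preimage v pv)) uv)
    (trans (≡sym (c≡c′ u refl pu)) (trans eq (c≡c′ v refl pv)))

-- PathK4 k is K4 with one edge subdivided once and the opposite edge p q subdivided k times;
-- equivalently, the complete bipartite graph with sides {a, p, q} and {b, b′} together with a
-- p–q path having k interior vertices, which is the edge p q itself when k = 0.
K4-subdivided : Graph
K4-subdivided = subdivide (K 4) (suc (suc zero)) (suc (suc (suc zero))) refl

PathK4 : ℕ → Graph
PathK4-qNeighbour : ∀ k → Fin (size (PathK4 k))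
PathK4-q : ∀ k → Fin (size (PathK4 k))
PathK4-qNeighbour-adj : ∀ k → adj (PathK4 k) (PathK4-qNeighbour k) (PathK4-q k) ≡ true
PathK4 zero = K4-subdivided
PathK4 (suc k) = subdivide (PathK4 k) (PathK4-qNeighbour k) (PathK4-q k) (PathK4-qNeighbour-adj k)
PathK4-qNeighbour zero = suc zero
PathK4-qNeighbour (suc k) = zero
PathK4-q zero = suc (suc zero)
PathK4-q (suc k) = suc (PathK4-q k)
PathK4-qNeighbour-adj zero = refl
PathK4-qNeighbour-adj (suc k) =
  trans (cong (⌊ PathK4-q k ≟ PathK4-qNeighbour k ⌋ ∨_) (⌊≟⌋-refl (PathK4-q k))) (BP.∨-zeroʳ _)

Iso-refl : ∀ H → Iso H H
Iso-refl H = ↔-id _ , λ u v → refl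

PathK4-isSubdivision : ∀ k → IsSubdivisionOfK4 (PathK4 k)
PathK4-isSubdivision zero =
  step (base (Iso-refl (K 4))) (suc (suc zero)) (suc (suc (suc zero))) refl (Iso-refl K4-subdivided)
PathK4-isSubdivision (suc k) =
  step (PathK4-isSubdivision k) (PathK4-qNeighbour k) (PathK4-q k) (PathK4-qNeighbour-adj k) (Iso-refl (PathK4 (suc k)))

-- inj₁ i is the i-th interior vertex of the q–p path counted from q, and inj₂ c is the
-- branch vertex c among a, p, q, b, b′ (in this order).
decode : ∀ k → Fin (size (PathK4 k)) → Fin k ⊎ Fin 5
decode zero i = inj₂ i
decode (suc k) zero = inj₁ zero
decode (suc k) (suc i) = Sum.map suc id (decode k i)

sameVertex : ∀ {k} → Fin k ⊎ Fin 5 → Fin k ⊎ Fin 5 → Bool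
sameVertex (inj₁ a) (inj₁ b) = toℕ a ≡ᵇ toℕ b
sameVertex (inj₂ a) (inj₂ b) = toℕ a ≡ᵇ toℕ b
sameVertex (inj₁ a) (inj₂ b) = false
sameVertex (inj₂ a) (inj₁ b) = false

sameVertex-suc : ∀ {k} (x y : Fin k ⊎ Fin 5) → sameVertex (Sum.map suc id x) (Sum.map suc id y) ≡ sameVertex x y
sameVertex-suc (inj₁ a) (inj₁ b) = refl
sameVertex-suc (inj₁ a) (inj₂ b) = refl
sameVertex-suc (inj₂ a) (inj₁ b) = refl
sameVertex-suc (inj₂ a) (inj₂ b) = refl

≡ᵇ-decode : ∀ k (i j : Fin (size (PathK4 k))) → (toℕ i ≡ᵇ toℕ j) ≡ sameVertex (decode k i) (decode k j)
≡ᵇ-decode zero i j = refl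
≡ᵇ-decode (suc k) zero zero = refl
≡ᵇ-decode (suc k) zero (suc j) with decode k j
... | inj₁ b = refl
... | inj₂ b = refl
≡ᵇ-decode (suc k) (suc i) zero with decode k i
... | inj₁ b = refl
... | inj₂ b = refl
≡ᵇ-decode (suc k) (suc i) (suc j) = trans (≡ᵇ-decode k i j) (≡sym (sameVertex-suc (decode k i) (decode k j)))

⌊≟⌋-decode : ∀ k (i j : Fin (size (PathK4 k))) → ⌊ i ≟ j ⌋ ≡ sameVertex (decode k i) (decode k j)
⌊≟⌋-decode k i j = trans (⌊≟⌋≡≡ᵇ i j) (≡ᵇ-decode k i j)

decode-q : ∀ k → decode k (PathK4-q k) ≡ inj₂ (suc (suc zero))
decode-q zero = refl
decode-q (suc k) rewrite decode-q k = refl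

consecutive : ℕ → ℕ → Bool
consecutive x y = (suc x ≡ᵇ y) ∨ (suc y ≡ᵇ x)

pathCoreAdj : ℕ → ℕ → Fin 5 → Bool
pathCoreAdj k a zero = false
pathCoreAdj k a (suc zero) = suc a ≡ᵇ k
pathCoreAdj k a (suc (suc zero)) = a ≡ᵇ 0
pathCoreAdj k a (suc (suc (suc _))) = false

coreAdj : ℕ → Fin 5 → Fin 5 → Bool
coreAdj k zero (suc (suc (suc _))) = true
coreAdj k (suc zero) (suc (suc zero)) = k ≡ᵇ 0
coreAdj k (suc zero) (suc (suc (suc _))) = true
coreAdj k (suc (suc zero)) (suc zero) = k ≡ᵇ 0
coreAdj k (suc (suc zero)) (suc (suc (suc _))) = true
coreAdj k (suc (suc (suc _))) zero = true
coreAdj k (suc (suc (suc _))) (suc zero) = true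
coreAdj k (suc (suc (suc _))) (suc (suc zero)) = true
coreAdj k _ _ = false

decodedAdj : (k : ℕ) → Fin k ⊎ Fin 5 → Fin k ⊎ Fin 5 → Bool
decodedAdj k (inj₁ a) (inj₁ b) = consecutive (toℕ a) (toℕ b)
decodedAdj k (inj₁ a) (inj₂ c) = pathCoreAdj k (toℕ a) c
decodedAdj k (inj₂ c) (inj₁ a) = pathCoreAdj k (toℕ a) c
decodedAdj k (inj₂ c) (inj₂ d) = coreAdj k c d

K4-subdivided-adj : ∀ i j → adj K4-subdivided i j ≡ coreAdj 0 i j
K4-subdivided-adj = from-yes (FP.all? (λ i → FP.all? (λ j → adj K4-subdivided i j BP.≟ coreAdj 0 i j)))

coreAdj-sym : ∀ k c d → coreAdj k c d ≡ coreAdj k d c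
coreAdj-sym zero = from-yes (FP.all? (λ i → FP.all? (λ j → coreAdj zero i j BP.≟ coreAdj zero j i)))
coreAdj-sym (suc k) = from-yes (FP.all? (λ i → FP.all? (λ j → coreAdj (suc k) i j BP.≟ coreAdj (suc k) j i)))

decodedAdj-sym : ∀ k x y → decodedAdj k x y ≡ decodedAdj k y x
decodedAdj-sym k (inj₁ a) (inj₁ b) = BP.∨-comm (suc (toℕ a) ≡ᵇ toℕ b) (suc (toℕ b) ≡ᵇ toℕ a)
decodedAdj-sym k (inj₁ a) (inj₂ c) = refl
decodedAdj-sym k (inj₂ c) (inj₁ a) = refl
decodedAdj-sym k (inj₂ c) (inj₂ d) = coreAdj-sym k c d

PathK4-adj-new : ∀ k j → adj (PathK4 (suc k)) zero (suc j) ≡ decodedAdj (suc k) (inj₁ zero) (Sum.map suc id (decode k j))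
PathK4-adj-new zero j rewrite ⌊≟⌋≡≡ᵇ j (suc zero) | ⌊≟⌋≡≡ᵇ j (suc (suc zero)) = h j
  where
  h : ∀ j → ((toℕ j ≡ᵇ 1) ∨ (toℕ j ≡ᵇ 2)) ≡ pathCoreAdj 1 0 j
  h = from-yes (FP.all? (λ j → ((toℕ j ≡ᵇ 1) ∨ (toℕ j ≡ᵇ 2)) BP.≟ pathCoreAdj 1 0 j))
PathK4-adj-new (suc k) j
  rewrite ⌊≟⌋-decode (suc k) j zero | ⌊≟⌋-decode (suc k) j (PathK4-q (suc k)) | decode-q (suc k)
  with decode (suc k) j
... | inj₁ b = ≡ᵇ0-sym (toℕ b)
  where
  ≡ᵇ0-sym : ∀ x → ((x ≡ᵇ 0) ∨ false) ≡ ((0 ≡ᵇ x) ∨ false)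
  ≡ᵇ0-sym zero = refl
  ≡ᵇ0-sym (suc x) = refl
... | inj₂ c = h c
  where
  h : ∀ c → (false ∨ (toℕ c ≡ᵇ 2)) ≡ pathCoreAdj (suc (suc k)) 0 c
  h = from-yes (FP.all? (λ c → (false ∨ (toℕ c ≡ᵇ 2)) BP.≟ pathCoreAdj (suc (suc k)) 0 c))

PathK4-adj : ∀ k i j → adj (PathK4 k) i j ≡ decodedAdj k (decode k i) (decode k j)
PathK4-adj zero i j = K4-subdivided-adj i j
PathK4-adj (suc k) zero zero = refl
PathK4-adj (suc k) zero (suc j) = PathK4-adj-new k j
PathK4-adj (suc k) (suc i) zero =
  trans (Graph.sym (PathK4 (suc k)) (suc i) zero)
        (trans (PathK4-adj-new k i) (decodedAdj-sym (suc k) (inj₁ zero) (Sum.map suc id (decode k i))))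
PathK4-adj (suc k) (suc i) (suc j)
  rewrite PathK4-adj k i j
        | ⌊≟⌋-decode k i (PathK4-qNeighbour k) | ⌊≟⌋-decode k j (PathK4-qNeighbour k)
        | ⌊≟⌋-decode k i (PathK4-q k) | ⌊≟⌋-decode k j (PathK4-q k) | decode-q k
  = subdivide-decodedAdj k (decode k i) (decode k j)
  where
  edge-kept : ∀ P A → (P ∧ not ((A ∧ false) ∨ false)) ≡ P
  edge-kept true true = refl
  edge-kept true false = refl
  edge-kept false A = refl

  edge-removed : ∀ A → (A ∧ not ((A ∧ true) ∨ false)) ≡ false
  edge-removed true = refl
  edge-removed false = refl

  edge-kept′ : ∀ P → (P ∧ not (false ∨ false)) ≡ P
  edge-kept′ true = refl
  edge-kept′ false = refl

  edge-removed′ : ∀ A → (A ∧ not (false ∨ (true ∧ A))) ≡ false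
  edge-removed′ true = refl
  edge-removed′ false = refl
  subdivide-decodedAdj : ∀ k (x y : Fin k ⊎ Fin 5) →
    (decodedAdj k x y ∧ not ((sameVertex x (decode k (PathK4-qNeighbour k)) ∧ sameVertex y (inj₂ (suc (suc zero))))
                          ∨ (sameVertex x (inj₂ (suc (suc zero))) ∧ sameVertex y (decode k (PathK4-qNeighbour k)))))
    ≡ decodedAdj (suc k) (Sum.map suc id x) (Sum.map suc id y)
  subdivide-decodedAdj zero (inj₂ c) (inj₂ d) = h c d
    where
    h : ∀ c d → (coreAdj 0 c d ∧ not (((toℕ c ≡ᵇ 1) ∧ (toℕ d ≡ᵇ 2)) ∨ ((toℕ c ≡ᵇ 2) ∧ (toℕ d ≡ᵇ 1)))) ≡ coreAdj 1 c d
    h = from-yes (FP.all? λ c → FP.all? λ d →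
          (coreAdj 0 c d ∧ not (((toℕ c ≡ᵇ 1) ∧ (toℕ d ≡ᵇ 2)) ∨ ((toℕ c ≡ᵇ 2) ∧ (toℕ d ≡ᵇ 1)))) BP.≟ coreAdj 1 c d)
  subdivide-decodedAdj (suc k) (inj₁ a) (inj₁ b) = edge-kept (consecutive (toℕ a) (toℕ b)) (toℕ a ≡ᵇ 0)
  subdivide-decodedAdj (suc k) (inj₁ a) (inj₂ zero) = refl
  subdivide-decodedAdj (suc k) (inj₁ a) (inj₂ (suc zero)) = edge-kept (toℕ a ≡ᵇ k) (toℕ a ≡ᵇ 0)
  subdivide-decodedAdj (suc k) (inj₁ a) (inj₂ (suc (suc zero))) = edge-removed (toℕ a ≡ᵇ 0)
  subdivide-decodedAdj (suc k) (inj₁ a) (inj₂ (suc (suc (suc zero)))) = refl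
  subdivide-decodedAdj (suc k) (inj₁ a) (inj₂ (suc (suc (suc (suc zero))))) = refl
  subdivide-decodedAdj (suc k) (inj₂ zero) (inj₁ a) = refl
  subdivide-decodedAdj (suc k) (inj₂ (suc zero)) (inj₁ a) = edge-kept′ (toℕ a ≡ᵇ k)
  subdivide-decodedAdj (suc k) (inj₂ (suc (suc zero))) (inj₁ a) = edge-removed′ (toℕ a ≡ᵇ 0)
  subdivide-decodedAdj (suc k) (inj₂ (suc (suc (suc zero)))) (inj₁ a) = refl
  subdivide-decodedAdj (suc k) (inj₂ (suc (suc (suc (suc zero))))) (inj₁ a) = refl
  subdivide-decodedAdj (suc k) (inj₂ c) (inj₂ d) = h c d
    where
    h : ∀ c d → (coreAdj (suc k) c d ∧ not ((false ∧ (toℕ d ≡ᵇ 2)) ∨ ((toℕ c ≡ᵇ 2) ∧ false))) ≡ coreAdj (suc (suc k)) c d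
    h = from-yes (FP.all? λ c → FP.all? λ d →
          (coreAdj (suc k) c d ∧ not ((false ∧ (toℕ d ≡ᵇ 2)) ∨ ((toℕ c ≡ᵇ 2) ∧ false))) BP.≟ coreAdj (suc (suc k)) c d)

sameVertex-refl : ∀ {k} (x : Fin k ⊎ Fin 5) → sameVertex x x ≡ true
sameVertex-refl (inj₁ a) = ≡ᵇ-refl (toℕ a)
sameVertex-refl (inj₂ a) = ≡ᵇ-refl (toℕ a)

decode-injective : ∀ k {u v : Fin (size (PathK4 k))} → decode k u ≡ decode k v → u ≡ v
decode-injective k {u} {v} e with u ≟ v | ⌊≟⌋-decode k u v
... | yes p | _ = p
... | no _ | q with () ← trans q (trans (cong (sameVertex (decode k u)) (≡sym e)) (sameVertex-refl (decode k u)))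

PathK4-embedding⇒ISK4 : (G : Graph) (k : ℕ) (g : Fin k ⊎ Fin 5 → Vertex G) →
  (∀ x y → g x ≡ g y → x ≡ y) → (∀ x y → adj G (g x) (g y) ≡ decodedAdj k x y) → ContainsISK4 G
PathK4-embedding⇒ISK4 G k g g-injective g-adj =
  PathK4 k , PathK4-isSubdivision k , g ∘ decode k ,
  (λ {u} {v} e → decode-injective k (g-injective _ _ e)) ,
  λ u v → trans (g-adj (decode k u) (decode k v)) (≡sym (PathK4-adj k u v))

contains-PathK4 : (G : Graph) (L : ℕ) (d : ℕ → Vertex G) (core : Fin 5 → Vertex G)
  → (∀ c e → core c ≡ core e → c ≡ e)
  → (∀ c e → adj G (core c) (core e) ≡ coreAdj (suc L) c e)
  → (∀ i j → i ≤ L → j ≤ L → d i ≡ d j → i ≡ j)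
  → (∀ i j → i ≤ L → j ≤ L → adj G (d i) (d j) ≡ consecutive i j)
  → (∀ i → i ≤ L → ∀ c → adj G (d i) (core c) ≡ pathCoreAdj (suc L) i c)
  → (∀ i → i ≤ L → ∀ c → ¬ d i ≡ core c)
  → ContainsISK4 G
contains-PathK4 G L d core core-inj core-adj d-inj d-adj d-core-adj d≢core =
  PathK4-embedding⇒ISK4 G (suc L) g g-injective g-adj
  where
  g : Fin (suc L) ⊎ Fin 5 → Vertex G
  g (inj₁ a) = d (toℕ a)
  g (inj₂ c) = core c
  ≤L : (a : Fin (suc L)) → toℕ a ≤ L
  ≤L = FP.toℕ≤pred[n]
  g-injective : ∀ x y → g x ≡ g y → x ≡ y
  g-injective (inj₁ a) (inj₁ b) e = cong inj₁ (FP.toℕ-injective (d-inj (toℕ a) (toℕ b) (≤L a) (≤L b) e))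
  g-injective (inj₁ a) (inj₂ c) e = ⊥-elim (d≢core (toℕ a) (≤L a) c e)
  g-injective (inj₂ c) (inj₁ a) e = ⊥-elim (d≢core (toℕ a) (≤L a) c (≡sym e))
  g-injective (inj₂ c) (inj₂ c′) e = cong inj₂ (core-inj c c′ e)
  g-adj : ∀ x y → adj G (g x) (g y) ≡ decodedAdj (suc L) x y
  g-adj (inj₁ a) (inj₁ b) = d-adj (toℕ a) (toℕ b) (≤L a) (≤L b)
  g-adj (inj₁ a) (inj₂ c) = d-core-adj (toℕ a) (≤L a) c
  g-adj (inj₂ c) (inj₁ a) = trans (Graph.sym G (core c) (d (toℕ a))) (d-core-adj (toℕ a) (≤L a) c)
  g-adj (inj₂ c) (inj₂ c′) = core-adj c c′

coreSide : Fin 5 → Bool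
coreSide zero = true
coreSide (suc zero) = true
coreSide (suc (suc zero)) = true
coreSide (suc (suc (suc _))) = false

coreAdj-bipartite : ∀ L c e →
  coreAdj (suc L) c e ≡ (if ⌊ c ≟ e ⌋ then false else (if coreSide c then not (coreSide e) else coreSide e))
coreAdj-bipartite L = from-yes (FP.all? λ c → FP.all? λ e →
  coreAdj (suc L) c e BP.≟ (if ⌊ c ≟ e ⌋ then false else (if coreSide c then not (coreSide e) else coreSide e)))

core-embedding : (G : Graph) (core : Fin 5 → Vertex G)
  → (∀ c e → coreSide c ≡ coreSide e → core c ≡ core e → c ≡ e)
  → (∀ c e → coreSide c ≡ true → coreSide e ≡ true → adj G (core c) (core e) ≡ false)
  → (∀ c e → coreSide c ≡ false → coreSide e ≡ false → adj G (core c) (core e) ≡ false)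
  → (∀ c e → coreSide c ≡ true → coreSide e ≡ false → adj G (core c) (core e) ≡ true)
  → (∀ c e → core c ≡ core e → c ≡ e) × (∀ L c e → adj G (core c) (core e) ≡ coreAdj (suc L) c e)
core-embedding G core sI hAA hBB hAB = cI , cA
  where
  hBA : ∀ c e → coreSide c ≡ false → coreSide e ≡ true → adj G (core c) (core e) ≡ true
  hBA c e p q = trans (Graph.sym G (core c) (core e)) (hAB e c q p)
  cI : ∀ c e → core c ≡ core e → c ≡ e
  cI c e p with coreSide c in ec | coreSide e in ee
  ... | true | true = sI c e (trans ec (≡sym ee)) p
  ... | false | false = sI c e (trans ec (≡sym ee)) p
  ... | true | false = ⊥-elim (adj⇒≢ G (hAB c e ec ee) p)
  ... | false | true = ⊥-elim (adj⇒≢ G (hBA c e ec ee) p)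
  cA : ∀ L c e → adj G (core c) (core e) ≡ coreAdj (suc L) c e
  cA L c e rewrite coreAdj-bipartite L c e with c ≟ e
  ... | yes refl = Graph.irrefl G (core c)
  ... | no _ with coreSide c in ec | coreSide e in ee
  ... | true | true = hAA c e ec ee
  ... | true | false = hAB c e ec ee
  ... | false | true = hBA c e ec ee
  ... | false | false = hBB c e ec ee

record Biclique (G : Graph) : Set where
  field
    inA inB : Vertex G → Bool
    A⇒¬B : ∀ v → inA v ≡ true → inB v ≡ false
    A-independent : ∀ u v → inA u ≡ true → inA v ≡ true → adj G u v ≡ false
    B-independent : ∀ u v → inB u ≡ true → inB v ≡ true → adj G u v ≡ false
    A-complete-B : ∀ u v → inA u ≡ true → inB v ≡ true → adj G u v ≡ true
    a1 a2 a3 b1 b2 b3 : Vertex G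
    a1A : inA a1 ≡ true
    a2A : inA a2 ≡ true
    a3A : inA a3 ≡ true
    b1B : inB b1 ≡ true
    b2B : inB b2 ≡ true
    b3B : inB b3 ≡ true
    a12 : ¬ a1 ≡ a2
    a13 : ¬ a1 ≡ a3
    a23 : ¬ a2 ≡ a3
    b12 : ¬ b1 ≡ b2
    b13 : ¬ b1 ≡ b3
    b23 : ¬ b2 ≡ b3

inK : ∀ {G} → Biclique G → Vertex G → Bool
inK K v = Biclique.inA K v ∨ Biclique.inB K v

swap : ∀ {G} → Biclique G → Biclique G
swap {G} K = record
  { inA = inB ; inB = inA
  ; A⇒¬B = λ v p → BP.¬-not (λ q → true⇒¬false p (A⇒¬B v q))
  ; A-independent = B-independent ; B-independent = A-independent
  ; A-complete-B = λ u v p q → trans (Graph.sym G u v) (A-complete-B v u q p)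
  ; a1 = b1 ; a2 = b2 ; a3 = b3 ; b1 = a1 ; b2 = a2 ; b3 = a3
  ; a1A = b1B ; a2A = b2B ; a3A = b3B ; b1B = a1A ; b2B = a2A ; b3B = a3A
  ; a12 = b12 ; a13 = b13 ; a23 = b23 ; b12 = a12 ; b13 = a13 ; b23 = a23 }
  where open Biclique K

Maximal : ∀ {G} → Biclique G → Set
Maximal {G} K = ∀ v → inK K v ≡ false →
  (¬ (∀ a → Biclique.inA K a ≡ true → adj G v a ≡ true)) × (¬ (∀ b → Biclique.inB K b ≡ true → adj G v b ≡ true))

inK-swap : ∀ {G} (K : Biclique G) v → inK (swap K) v ≡ inK K v
inK-swap K v = BP.∨-comm (Biclique.inB K v) (Biclique.inA K v)

Maximal-swap : ∀ {G} (K : Biclique G) → Maximal K → Maximal (swap K)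
Maximal-swap K m v p = proj₂ (m v (trans (≡sym (inK-swap K v)) p)) , proj₁ (m v (trans (≡sym (inK-swap K v)) p))

isk4-from-path : ∀ {G} (K : Biclique G) (L : ℕ) (d : ℕ → Vertex G) (P Q A3 B2 B3 : Vertex G)
  → Biclique.inA K P ≡ true → Biclique.inA K Q ≡ true → Biclique.inA K A3 ≡ true
  → Biclique.inB K B2 ≡ true → Biclique.inB K B3 ≡ true
  → ¬ P ≡ Q → ¬ P ≡ A3 → ¬ Q ≡ A3 → ¬ B2 ≡ B3
  → (∀ i → i ≤ L → inK K (d i) ≡ false)
  → (∀ i j → i ≤ L → j ≤ L → d i ≡ d j → i ≡ j)
  → (∀ i j → i ≤ L → j ≤ L → adj G (d i) (d j) ≡ consecutive i j)
  → (∀ i → i ≤ L → adj G (d i) Q ≡ (i ≡ᵇ 0))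
  → (∀ i → i ≤ L → adj G (d i) P ≡ (i ≡ᵇ L))
  → (∀ i → i ≤ L → adj G (d i) A3 ≡ false)
  → (∀ i → i ≤ L → adj G (d i) B2 ≡ false)
  → (∀ i → i ≤ L → adj G (d i) B3 ≡ false)
  → ContainsISK4 G
isk4-from-path {G} K L d P Q A3 B2 B3 pA qA hA3 hB2 hB3 pq pa qa bb dout dI dA dQ dP dA3 dB2 dB3 =
  contains-PathK4 G L d core (proj₁ CM) (proj₂ CM L) dI dA dc dn
  where
  open Biclique K
  core : Fin 5 → Vertex G
  core zero = A3
  core (suc zero) = P
  core (suc (suc zero)) = Q
  core (suc (suc (suc zero))) = B2
  core (suc (suc (suc (suc zero)))) = B3
  cAin : ∀ c → coreSide c ≡ true → inA (core c) ≡ true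
  cAin zero _ = hA3
  cAin (suc zero) _ = pA
  cAin (suc (suc zero)) _ = qA
  cBin : ∀ c → coreSide c ≡ false → inB (core c) ≡ true
  cBin (suc (suc (suc zero))) _ = hB2
  cBin (suc (suc (suc (suc zero)))) _ = hB3
  sI : ∀ c e → coreSide c ≡ coreSide e → core c ≡ core e → c ≡ e
  sI zero zero _ _ = refl
  sI zero (suc zero) _ p = ⊥-elim (pa (≡sym p))
  sI zero (suc (suc zero)) _ p = ⊥-elim (qa (≡sym p))
  sI (suc zero) zero _ p = ⊥-elim (pa p)
  sI (suc zero) (suc zero) _ _ = refl
  sI (suc zero) (suc (suc zero)) _ p = ⊥-elim (pq p)
  sI (suc (suc zero)) zero _ p = ⊥-elim (qa p)
  sI (suc (suc zero)) (suc zero) _ p = ⊥-elim (pq (≡sym p))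
  sI (suc (suc zero)) (suc (suc zero)) _ _ = refl
  sI (suc (suc (suc zero))) (suc (suc (suc zero))) _ _ = refl
  sI (suc (suc (suc zero))) (suc (suc (suc (suc zero)))) _ p = ⊥-elim (bb p)
  sI (suc (suc (suc (suc zero)))) (suc (suc (suc zero))) _ p = ⊥-elim (bb (≡sym p))
  sI (suc (suc (suc (suc zero)))) (suc (suc (suc (suc zero)))) _ _ = refl
  CM = core-embedding G core sI (λ c e p q → A-independent _ _ (cAin c p) (cAin e q))
         (λ c e p q → B-independent _ _ (cBin c p) (cBin e q)) (λ c e p q → A-complete-B _ _ (cAin c p) (cBin e q))
  dc : ∀ i → i ≤ L → ∀ c → adj G (d i) (core c) ≡ pathCoreAdj (suc L) i c
  dc i h zero = dA3 i h
  dc i h (suc zero) = dP i h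
  dc i h (suc (suc zero)) = dQ i h
  dc i h (suc (suc (suc zero))) = dB2 i h
  dc i h (suc (suc (suc (suc zero)))) = dB3 i h
  cK : ∀ c → inK K (core c) ≡ true
  cK zero = ∨-introˡ _ hA3
  cK (suc zero) = ∨-introˡ _ pA
  cK (suc (suc zero)) = ∨-introˡ _ qA
  cK (suc (suc (suc zero))) = ∨-introʳ _ hB2
  cK (suc (suc (suc (suc zero)))) = ∨-introʳ _ hB3
  dn : ∀ i → i ≤ L → ∀ c → ¬ d i ≡ core c
  dn i h c p = true⇒¬false (cK c) (trans (cong (inK K) (≡sym p)) (dout i h))

module _ {G : Graph} (K : Biclique G) (mx : Maximal K) (tfG : TriangleFree G) (ifG : ISK4Free G) where
  open Biclique K

  -- By maximality some a ∈ A is not adjacent to v; then v, x, y, a, b1, b2 form PathK4 1.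
  two-neighbours-in-A : ∀ v x y → inK K v ≡ false → inA x ≡ true → inA y ≡ true → ¬ x ≡ y →
        adj G v x ≡ true → adj G v y ≡ true → ⊥
  two-neighbours-in-A v x y out xA yA xy vx vy with FP.all? (λ a → (inA a BP.≟ true) →-dec (adj G v a BP.≟ true))
  ... | yes h = proj₁ (mx v out) h
  ... | no h with FP.¬∀⟶∃¬ _ _ (λ a → (inA a BP.≟ true) →-dec (adj G v a BP.≟ true)) h
  ... | a , na = ifG (isk4-from-path K 0 (λ _ → v) y x a b1 b2 yA xA aA b1B b2B (λ e → xy (≡sym e)) ya xa b12
          (λ { i z≤n → out }) (λ { i j z≤n z≤n _ → refl }) (λ { i j z≤n z≤n → Graph.irrefl G v })
          (λ { i z≤n → vx }) (λ { i z≤n → vy }) (λ { i z≤n → va }) (λ { i z≤n → vb b1 b1B }) (λ { i z≤n → vb b2 b2B }))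
    where
    aA : inA a ≡ true
    aA with inA a in e
    ... | true = refl
    ... | false = ⊥-elim (na (λ ()))
    va : adj G v a ≡ false
    va = BP.¬-not (λ q → na (λ _ → q))
    ya : ¬ y ≡ a
    ya refl = true⇒¬false vy va
    xa : ¬ x ≡ a
    xa refl = true⇒¬false vx va
    vb : ∀ b → inB b ≡ true → adj G v b ≡ false
    vb b bB = BP.¬-not (λ q → tfG (triangle G v x b vx (A-complete-B x b xA bB) q))

unique-neighbour-in-K : ∀ {G} (K : Biclique G) → Maximal K → TriangleFree G → ISK4Free G →
  ∀ v x y → inK K v ≡ false → inK K x ≡ true → inK K y ≡ true →
     adj G v x ≡ true → adj G v y ≡ true → x ≡ y
unique-neighbour-in-K {G} K mx tfG ifG v x y out xK yK vx vy with x ≟ y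
... | yes p = p
... | no xy with ∨-elim (Biclique.inA K x) _ xK | ∨-elim (Biclique.inA K y) _ yK
... | inj₁ xA | inj₁ yA = ⊥-elim (two-neighbours-in-A K mx tfG ifG v x y out xA yA xy vx vy)
... | inj₂ xB | inj₂ yB =
  ⊥-elim (two-neighbours-in-A (swap K) (Maximal-swap K mx) tfG ifG v x y (trans (inK-swap K v) out) xB yB xy vx vy)
... | inj₁ xA | inj₂ yB = ⊥-elim (tfG (triangle G v x y vx (Biclique.A-complete-B K x y xA yB) vy))
... | inj₂ xB | inj₁ yA = ⊥-elim (tfG (triangle G v x y vx (trans (Graph.sym G x y) (Biclique.A-complete-B K y x yA xB)) vy))

outside : ∀ {G} → Biclique G → ℕ
outside K = count (λ v → not (inK K v))

outside-swap : ∀ {G} (K : Biclique G) → outside (swap K) ≡ outside K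
outside-swap K = count-cong _ _ (λ v → cong not (inK-swap K v))

extend-B : ∀ {G} → TriangleFree G → (K : Biclique G) → (v : Vertex G) → inK K v ≡ false →
  (∀ a → Biclique.inA K a ≡ true → adj G v a ≡ true) →
       Σ (Biclique G) λ K' → outside K' < outside K
extend-B {G} tfG K v out h = K' , subst (_< outside K) reassociate (count-¬∪-< (inK K) v out)
  where
  open Biclique K
  isv : Vertex G → Bool
  isv w = ⌊ w ≟ v ⌋
  vA : inA v ≡ false
  vA = proj₁ (∨-false⁻ _ _ out)
  vb : ∀ b → inB b ≡ true → adj G b v ≡ false
  vb b bB = BP.¬-not (λ q → tfG (triangle G v a1 b (h a1 a1A) (A-complete-B a1 b a1A bB) (trans (Graph.sym G v b) q)))
  inB' : Vertex G → Bool
  inB' w = inB w ∨ isv w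
  disj' : ∀ w → inA w ≡ true → inB' w ≡ false
  disj' w wA with w ≟ v
  ... | yes refl = ⊥-elim (true⇒¬false wA vA)
  ... | no _ = trans (BP.∨-identityʳ (inB w)) (A⇒¬B w wA)
  BB' : ∀ u w → inB' u ≡ true → inB' w ≡ true → adj G u w ≡ false
  BB' u w p q with ∨-elim (inB u) _ p | ∨-elim (inB w) _ q
  ... | inj₁ uB | inj₁ wB = B-independent u w uB wB
  ... | inj₁ uB | inj₂ wv rewrite ⌊≟⌋⇒≡ {w = w} wv = vb u uB
  ... | inj₂ uv | inj₁ wB rewrite ⌊≟⌋⇒≡ {w = u} uv = trans (Graph.sym G v w) (vb w wB)
  ... | inj₂ uv | inj₂ wv rewrite ⌊≟⌋⇒≡ {w = u} uv | ⌊≟⌋⇒≡ {w = w} wv = Graph.irrefl G v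
  AB' : ∀ u w → inA u ≡ true → inB' w ≡ true → adj G u w ≡ true
  AB' u w uA q with ∨-elim (inB w) _ q
  ... | inj₁ wB = A-complete-B u w uA wB
  ... | inj₂ wv rewrite ⌊≟⌋⇒≡ {w = w} wv = trans (Graph.sym G u v) (h u uA)
  K' : Biclique G
  K' = record { inA = inA ; inB = inB' ; A⇒¬B = disj' ; A-independent = A-independent ; B-independent = BB' ; A-complete-B = AB'
    ; a1 = a1 ; a2 = a2 ; a3 = a3 ; b1 = b1 ; b2 = b2 ; b3 = b3
    ; a1A = a1A ; a2A = a2A ; a3A = a3A ; b1B = ∨-introˡ _ b1B ; b2B = ∨-introˡ _ b2B ; b3B = ∨-introˡ _ b3B
    ; a12 = a12 ; a13 = a13 ; a23 = a23 ; b12 = b12 ; b13 = b13 ; b23 = b23 }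
  reassociate : count (λ w → not (inK K w ∨ isv w)) ≡ outside K'
  reassociate = count-cong _ _ (λ w → cong not (BP.∨-assoc (inA w) (inB w) (isv w)))

extend-A : ∀ {G} → TriangleFree G → (K : Biclique G) → (v : Vertex G) → inK K v ≡ false →
  (∀ b → Biclique.inB K b ≡ true → adj G v b ≡ true) →
       Σ (Biclique G) λ K' → outside K' < outside K
extend-A tfG K v out h with extend-B tfG (swap K) v (trans (inK-swap K v) out) h
... | K' , lt = swap K' , subst₂ _<_ (≡sym (outside-swap K')) (outside-swap K) lt

maximal-extension′ : ∀ {G} → TriangleFree G → (fuel : ℕ) → (K : Biclique G) → outside K < fuel →
                     Σ (Biclique G) Maximal
maximal-extension′ tfG zero K ()
maximal-extension′ {G} tfG (suc fuel) K (s≤s lt)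
  with FP.any? (λ v → (inK K v BP.≟ false) ×-dec FP.all? (λ a → (Biclique.inA K a BP.≟ true) →-dec (adj G v a BP.≟ true)))
... | yes (v , out , h) = let K′ , lt′ = extend-B tfG K v out h in maximal-extension′ tfG fuel K′ (≤-trans lt′ lt)
... | no ¬A-complete
  with FP.any? (λ v → (inK K v BP.≟ false) ×-dec FP.all? (λ b → (Biclique.inB K b BP.≟ true) →-dec (adj G v b BP.≟ true)))
... | yes (v , out , h) = let K′ , lt′ = extend-A tfG K v out h in maximal-extension′ tfG fuel K′ (≤-trans lt′ lt)
... | no ¬B-complete = K , λ v out → (λ h → ¬A-complete (v , out , h)) , (λ h → ¬B-complete (v , out , h))

maximal-extension : ∀ {G} → TriangleFree G → Biclique G → Σ (Biclique G) Maximal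
maximal-extension tfG K = maximal-extension′ tfG (suc (outside K)) K ≤-refl

<⇒≡suc+ : ∀ {i j} → i < j → Σ ℕ λ D → j ≡ suc i + D
<⇒≡suc+ {zero} {suc j} (s≤s z≤n) = j , refl
<⇒≡suc+ {suc i} {suc j} (s≤s lt) with <⇒≡suc+ lt
... | D , e = D , cong suc e

consecutive-irrefl : ∀ i → consecutive i i ≡ false
consecutive-irrefl i = ∨-false (≢⇒≡ᵇ-false (suc i) i NP.1+n≢n) (≢⇒≡ᵇ-false (suc i) i NP.1+n≢n)

consecutive-suc : ∀ i → consecutive i (suc i) ≡ true
consecutive-suc i = ∨-introˡ _ (≡ᵇ-refl (suc i))

consecutive-far : ∀ i d → consecutive i (suc i + suc d) ≡ false
consecutive-far i d = ∨-false (≢⇒≡ᵇ-false (suc i) (suc i + suc d) below) (≢⇒≡ᵇ-false (suc (suc i + suc d)) i above)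
  where
  below : ¬ suc i ≡ suc i + suc d
  below e = NP.m≢1+m+n i (trans (NP.suc-injective e) (NP.+-suc i d))
  above : ¬ suc (suc i + suc d) ≡ i
  above e = NP.m≢1+m+n i (trans (≡sym e) (cong suc (≡sym (NP.+-suc i (suc d)))))

consecutive-sym : ∀ i j → consecutive i j ≡ consecutive j i
consecutive-sym i j = BP.∨-comm (suc i ≡ᵇ j) (suc j ≡ᵇ i)

one-of-three-avoiding-two : ∀ {A : Set} (P : A → Set) (deq : (a b : A) → Dec (a ≡ b)) (x1 x2 x3 p q : A) →
        P x1 → P x2 → P x3 →
        ¬ x1 ≡ x2 → ¬ x1 ≡ x3 → ¬ x2 ≡ x3 → Σ A λ x → P x × ¬ x ≡ p × ¬ x ≡ q
one-of-three-avoiding-two P deq x1 x2 x3 p q h1 h2 h3 n12 n13 n23 with deq x1 p | deq x1 q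
... | no a | no b = x1 , h1 , a , b
... | yes refl | yes refl = x2 , h2 , (λ e → n12 (≡sym e)) , (λ e → n12 (≡sym e))
... | yes refl | no b with deq x2 q
... | no c = x2 , h2 , (λ e → n12 (≡sym e)) , c
... | yes refl = x3 , h3 , (λ e → n13 (≡sym e)) , (λ e → n23 (≡sym e))
one-of-three-avoiding-two P deq x1 x2 x3 p q h1 h2 h3 n12 n13 n23 | no a | yes refl with deq x2 p
... | no c = x2 , h2 , c , (λ e → n12 (≡sym e))
... | yes refl = x3 , h3 , (λ e → n23 (≡sym e)) , (λ e → n13 (≡sym e))

two-of-three-avoiding-one : ∀ {A : Set} (P : A → Set) (deq : (a b : A) → Dec (a ≡ b)) (x1 x2 x3 r : A) →
        P x1 → P x2 → P x3 → ¬ x1 ≡ x2 → ¬ x1 ≡ x3 → ¬ x2 ≡ x3 →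
        Σ A λ y → Σ A λ y' → P y × P y' × ¬ y ≡ y' × ¬ y ≡ r × ¬ y' ≡ r
two-of-three-avoiding-one P deq x1 x2 x3 r h1 h2 h3 n12 n13 n23 with deq x1 r
... | yes refl = x2 , x3 , h2 , h3 , n23 , (λ e → n12 (≡sym e)) , (λ e → n13 (≡sym e))
... | no a with deq x2 r
... | yes refl = x1 , x3 , h1 , h3 , n13 , a , (λ e → n23 (≡sym e))
... | no b = x1 , x2 , h1 , h2 , n12 , a , b

module _ {G : Graph} (K : Biclique G) (mx : Maximal K) (tfG : TriangleFree G) (ifG : ISK4Free G) where
  open Biclique K

  -- The interior of the path sees in K only a common neighbour r of p and q, necessarily in B.
  -- The path, p, q, a third vertex of A and two vertices of B other than r form PathK4 (suc L).
  induced-linkage-impossible : ∀ L (c : ℕ → Vertex G) (p q : Vertex G)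
    → (∀ i → i ≤ L → inK K (c i) ≡ false)
    → (∀ i → i < L → adj G (c i) (c (suc i)) ≡ true)
    → inK K p ≡ true → inK K q ≡ true → ¬ p ≡ q → adj G p q ≡ false
    → adj G (c 0) p ≡ true → adj G (c L) q ≡ true
    → inA p ≡ true
    → (∀ i D → suc i + D ≤ L → ¬ c i ≡ c (suc i + D))
    → (∀ i d → suc i + suc d ≤ L → adj G (c i) (c (suc i + suc d)) ≡ false)
    → (∀ i → 0 < i → i < L → ∀ z → inK K z ≡ true → adj G (c i) z ≡ true → adj G z p ≡ true × adj G z q ≡ true)
    → (∀ i D → 0 < i → suc i + D < L → ∀ z z' → inK K z ≡ true → inK K z' ≡ true → adj G (c i) z ≡ true →
         adj G (c (suc i + D)) z' ≡ true → z ≡ z' ⊎ adj G z z' ≡ true)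
    → ⊥
  induced-linkage-impossible L c p q out stp pK qK pq npq c0 cL pA noRep noCh attOK attU =
    ifG (isk4-from-path K L c q p A3 B2 B3 qA pA A3A B2B B3B
           (λ e → pq (≡sym e)) (λ e → A3q (≡sym e)) (λ e → A3p (≡sym e)) B23
           out dI dA dQ dP dA3 dB2 dB3)
    where
    qA : inA q ≡ true
    qA with ∨-elim (inA q) _ qK
    ... | inj₁ h = h
    ... | inj₂ qB = ⊥-elim (true⇒¬false (A-complete-B p q pA qB) npq)
    attachment-in-B : ∀ z → inK K z ≡ true → adj G z p ≡ true → inB z ≡ true
    attachment-in-B z zK zp with ∨-elim (inA z) _ zK
    ... | inj₁ zA = ⊥-elim (true⇒¬false zp (A-independent z p zA pA))
    ... | inj₂ h = h
    interior-attachment? : Dec (Σ ℕ λ i → i < L × (0 < i × Σ (Vertex G) λ z → inK K z ≡ true × adj G (c i) z ≡ true))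
    interior-attachment? = NP.anyUpTo? (λ i → (0 <? i) ×-dec FP.any? (λ z → (inK K z BP.≟ true) ×-dec (adj G (c i) z BP.≟ true))) L
    single-interior-attachment :
      Σ (Vertex G) λ r → ∀ i → 0 < i → i < L → ∀ z → inK K z ≡ true → adj G (c i) z ≡ true → z ≡ r
    single-interior-attachment with interior-attachment?
    ... | no n = p , λ i h1 h2 z zK a → ⊥-elim (n (i , h2 , h1 , z , zK , a))
    ... | yes (i0 , i0L , i0p , r , rK , ar) = r , unique
      where
      unique : ∀ i → 0 < i → i < L → ∀ z → inK K z ≡ true → adj G (c i) z ≡ true → z ≡ r
      unique i h1 h2 z zK a with NP.<-cmp i i0
      ... | tri≈ _ refl _ = unique-neighbour-in-K K mx tfG ifG (c i) z r (out i (NP.<⇒≤ h2)) zK rK a ar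
      ... | tri< lt _ _ with <⇒≡suc+ lt
      ... | D , e with attU i D h1 (subst (_< L) e i0L) z r zK rK a (subst (λ t → adj G (c t) r ≡ true) e ar)
      ... | inj₁ zr = zr
      ... | inj₂ azr = ⊥-elim (true⇒¬false azr (B-independent z r (attachment-in-B z zK (proj₁ (attOK i h1 h2 z zK a)))
                                                                    (attachment-in-B r rK (proj₁ (attOK i0 i0p i0L r rK ar)))))
      unique i h1 h2 z zK a | tri> _ _ gt with <⇒≡suc+ gt
      ... | D , e with attU i0 D i0p (subst (_< L) e h2) r z rK zK ar (subst (λ t → adj G (c t) z ≡ true) e a)
      ... | inj₁ rz = ≡sym rz
      ... | inj₂ arz = ⊥-elim (true⇒¬false arz (B-independent r z (attachment-in-B r rK (proj₁ (attOK i0 i0p i0L r rK ar)))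
                                                                    (attachment-in-B z zK (proj₁ (attOK i h1 h2 z zK a)))))
    r = proj₁ single-interior-attachment
    PA = one-of-three-avoiding-two (λ x → inA x ≡ true) _≟_ a1 a2 a3 p q a1A a2A a3A a12 a13 a23
    A3 = proj₁ PA
    A3A = proj₁ (proj₂ PA)
    A3p = proj₁ (proj₂ (proj₂ PA))
    A3q = proj₂ (proj₂ (proj₂ PA))
    PB = two-of-three-avoiding-one (λ x → inB x ≡ true) _≟_ b1 b2 b3 r b1B b2B b3B b12 b13 b23
    B2 = proj₁ PB
    B3 = proj₁ (proj₂ PB)
    B2B = proj₁ (proj₂ (proj₂ PB))
    B3B = proj₁ (proj₂ (proj₂ (proj₂ PB)))
    B23 = proj₁ (proj₂ (proj₂ (proj₂ (proj₂ PB))))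
    B2r = proj₁ (proj₂ (proj₂ (proj₂ (proj₂ (proj₂ PB)))))
    B3r = proj₂ (proj₂ (proj₂ (proj₂ (proj₂ (proj₂ PB)))))
    dI : ∀ i j → i ≤ L → j ≤ L → c i ≡ c j → i ≡ j
    dI i j iL jL eq with NP.<-cmp i j
    ... | tri≈ _ e _ = e
    ... | tri< lt _ _ with <⇒≡suc+ lt
    ... | D , e = ⊥-elim (noRep i D (subst (_≤ L) e jL) (subst (λ t → c i ≡ c t) e eq))
    dI i j iL jL eq | tri> _ _ gt with <⇒≡suc+ gt
    ... | D , e = ⊥-elim (noRep j D (subst (_≤ L) e iL) (subst (λ t → c j ≡ c t) e (≡sym eq)))
    dAlt : ∀ i D → suc i + D ≤ L → adj G (c i) (c (suc i + D)) ≡ consecutive i (suc i + D)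
    dAlt i zero h rewrite NP.+-identityʳ i = trans (stp i h) (≡sym (consecutive-suc i))
    dAlt i (suc d) h = trans (noCh i d h) (≡sym (consecutive-far i d))
    dA : ∀ i j → i ≤ L → j ≤ L → adj G (c i) (c j) ≡ consecutive i j
    dA i j iL jL with NP.<-cmp i j
    ... | tri≈ _ refl _ = trans (Graph.irrefl G (c i)) (≡sym (consecutive-irrefl i))
    ... | tri< lt _ _ with <⇒≡suc+ lt
    ... | D , refl = dAlt i D jL
    dA i j iL jL | tri> _ _ gt with <⇒≡suc+ gt
    ... | D , refl = trans (Graph.sym G (c i) (c j)) (trans (dAlt j D iL) (consecutive-sym j i))
    K-neighbours : ∀ i → i ≤ L → ∀ z → inK K z ≡ true → adj G (c i) z ≡ true →
          (i ≡ 0 × z ≡ p) ⊎ ((i ≡ L × z ≡ q) ⊎ (z ≡ r × adj G z p ≡ true × adj G z q ≡ true))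
    K-neighbours zero h z zK a = inj₁ (refl , unique-neighbour-in-K K mx tfG ifG (c 0) z p (out 0 z≤n) zK pK a c0)
    K-neighbours (suc i) h z zK a with suc i NP.≟ L
    ... | yes refl = inj₂ (inj₁ (refl , unique-neighbour-in-K K mx tfG ifG (c (suc i)) z q (out (suc i) h) zK qK a cL))
    ... | no ne = inj₂ (inj₂ (proj₂ single-interior-attachment (suc i) (s≤s z≤n) (NP.≤∧≢⇒< h ne) z zK a ,
                              attOK (suc i) (s≤s z≤n) (NP.≤∧≢⇒< h ne) z zK a))
    dQ : ∀ i → i ≤ L → adj G (c i) p ≡ (i ≡ᵇ 0)
    dQ zero h = c0
    dQ (suc i) h = BP.¬-not λ a → ff (K-neighbours (suc i) h p pK a)
      where
      ff : _ → ⊥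
      ff (inj₁ (() , _))
      ff (inj₂ (inj₁ (_ , e))) = pq e
      ff (inj₂ (inj₂ (_ , app , _))) = true⇒¬false app (Graph.irrefl G p)
    dP : ∀ i → i ≤ L → adj G (c i) q ≡ (i ≡ᵇ L)
    dP i h with i NP.≟ L
    ... | yes refl = trans cL (≡sym (≡ᵇ-refl i))
    ... | no ne = trans (BP.¬-not λ a → ff (K-neighbours i h q qK a)) (≡sym (≢⇒≡ᵇ-false i L ne))
      where
      ff : _ → ⊥
      ff (inj₁ (_ , e)) = pq (≡sym e)
      ff (inj₂ (inj₁ (e , _))) = ne e
      ff (inj₂ (inj₂ (_ , _ , aqq))) = true⇒¬false aqq (Graph.irrefl G q)
    dA3 : ∀ i → i ≤ L → adj G (c i) A3 ≡ false
    dA3 i h = BP.¬-not λ a → ff (K-neighbours i h A3 (∨-introˡ _ A3A) a)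
      where
      ff : _ → ⊥
      ff (inj₁ (_ , e)) = A3p e
      ff (inj₂ (inj₁ (_ , e))) = A3q e
      ff (inj₂ (inj₂ (_ , ap , _))) = true⇒¬false ap (A-independent A3 p A3A pA)
    dBx : ∀ B → inB B ≡ true → ¬ B ≡ r → ∀ i → i ≤ L → adj G (c i) B ≡ false
    dBx B BB' Br i h = BP.¬-not λ a → ff (K-neighbours i h B (∨-introʳ (inA B) BB') a)
      where
      ff : _ → ⊥
      ff (inj₁ (_ , refl)) = true⇒¬false BB' (A⇒¬B B pA)
      ff (inj₂ (inj₁ (_ , refl))) = true⇒¬false BB' (A⇒¬B B qA)
      ff (inj₂ (inj₂ (e , _))) = Br e
    dB2 = dBx B2 B2B B2r
    dB3 = dBx B3 B3B B3r

m<m+suc : ∀ m d → m < m + suc d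
m<m+suc zero d = s≤s z≤n
m<m+suc (suc m) d = s≤s (m<m+suc m d)

+suc≡⇒< : ∀ {a b L} → a + suc b ≡ L → a < L
+suc≡⇒< {a} {b} refl = m<m+suc a b

module _ {G : Graph} (K : Biclique G) (mx : Maximal K) (tfG : TriangleFree G) (ifG : ISK4Free G) where
  open Biclique K

  record Linkage (L : ℕ) : Set where
    field
      c : ℕ → Vertex G
      p q : Vertex G
      out : ∀ i → i ≤ L → inK K (c i) ≡ false
      stp : ∀ i → i < L → adj G (c i) (c (suc i)) ≡ true
      pK : inK K p ≡ true
      qK : inK K q ≡ true
      pq : ¬ p ≡ q
      npq : adj G p q ≡ false
      c0 : adj G (c 0) p ≡ true
      cL : adj G (c L) q ≡ true

  sub-linkage : ∀ {L} (w : Linkage L) (i l : ℕ) → l + i ≤ L →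
        (z z' : Vertex G) → inK K z ≡ true → inK K z' ≡ true → ¬ z ≡ z' →
        adj G z z' ≡ false → adj G (Linkage.c w i) z ≡ true → adj G (Linkage.c w (l + i)) z' ≡ true → Linkage l
  sub-linkage w i l h z z' zK z'K zz nzz a a' = record { c = λ t → c (t + i) ; p = z ; q = z'
    ; out = λ t tl → out (t + i) (≤-trans (NP.+-monoˡ-≤ i tl) h)
    ; stp = λ t tl → stp (t + i) (≤-trans (NP.+-monoˡ-≤ i tl) h)
    ; pK = zK ; qK = z'K ; pq = zz ; npq = nzz ; c0 = a ; cL = a' }
    where open Linkage w

  shortcut-linkage : ∀ {L} (w : Linkage L) (i d L' : ℕ) → L' + suc d ≡ L → suc i + suc d ≤ L →
             adj G (Linkage.c w i) (Linkage.c w (suc i + suc d)) ≡ true → Linkage L'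
  shortcut-linkage {L} w i d L' eL hj ch = record { c = c' ; p = p ; q = q ; out = out' ; stp = stp'
    ; pK = pK ; qK = qK ; pq = pq ; npq = npq ; c0 = subst (λ x → adj G x p ≡ true) (≡sym (cle 0 z≤n)) c0 ; cL = cL' }
    where
    open Linkage w
    D = suc d
    pk : ∀ t → Dec (t ≤ i) → Vertex G
    pk t (yes _) = c t
    pk t (no _) = c (t + D)
    c' : ℕ → Vertex G
    c' t = pk t (t ≤? i)
    cle : ∀ t → t ≤ i → c' t ≡ c t
    cle t h with t ≤? i
    ... | yes _ = refl
    ... | no n = ⊥-elim (n h)
    cgt : ∀ t → ¬ t ≤ i → c' t ≡ c (t + D)
    cgt t h with t ≤? i
    ... | yes y = ⊥-elim (h y)
    ... | no _ = refl
    iL : i ≤ L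
    iL = ≤-trans (NP.m≤n⇒m≤1+n ≤-refl) (≤-trans (NP.m≤m+n (suc i) D) hj)
    tD : ∀ t → t ≤ L' → t + D ≤ L
    tD t h = subst (t + D ≤_) eL (NP.+-monoˡ-≤ D h)
    out' : ∀ t → t ≤ L' → inK K (c' t) ≡ false
    out' t h with t ≤? i
    ... | yes y = out t (≤-trans y iL)
    ... | no _ = out (t + D) (tD t h)
    stp' : ∀ t → t < L' → adj G (c' t) (c' (suc t)) ≡ true
    stp' t h with t ≤? i | suc t ≤? i
    ... | yes y | yes y' = stp t (≤-trans y' iL)
    ... | yes y | no n' with NP.m≤n⇒m<n∨m≡n y
    ...   | inj₁ lt = ⊥-elim (n' lt)
    ...   | inj₂ refl = ch
    stp' t h | no n | yes y' = ⊥-elim (n (≤-trans (NP.n≤1+n t) y'))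
    stp' t h | no n | no n' = stp (t + D) (tD (suc t) h)
    L'i : ¬ L' ≤ i
    L'i h = NP.<-irrefl refl (≤-trans (s≤s (NP.+-monoˡ-≤ D h)) (subst (suc i + D ≤_) (≡sym eL) hj))
    cL' : adj G (c' L') q ≡ true
    cL' rewrite cgt L' L'i | eL = cL

  -- A repeated vertex, a chord, an interior attachment missing p or q, or two non-adjacent
  -- interior attachments each yield a shorter linkage; induced-linkage-impossible excludes the rest.
  no-linkage′ : ∀ fuel L → L < fuel → Linkage L → ⊥
  no-linkage′ zero L () w
  no-linkage′ (suc fuel) zero _ w = pq (unique-neighbour-in-K K mx tfG ifG (c 0) p q (out 0 z≤n) pK qK c0 cL)
    where open Linkage w
  no-linkage′ (suc fuel) (suc L0) (s≤s lt) w = shorten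
    where
    open Linkage w
    L = suc L0
    shorter : ∀ {L'} → L' < L → Linkage L' → ⊥
    shorter {L'} l w' = no-linkage′ fuel L' (≤-trans l lt) w'
    RepetitionOrChord : ℕ → Set
    RepetitionOrChord i = Σ ℕ λ D → D < suc L ×
      (suc i + D ≤ L × (c i ≡ c (suc i + D) ⊎ (0 < D × adj G (c i) (c (suc i + D)) ≡ true)))
    BadAttachment : ℕ → Set
    BadAttachment i = 0 < i × Σ (Vertex G) λ z → inK K z ≡ true ×
      (adj G (c i) z ≡ true × ((¬ z ≡ p × adj G z p ≡ false) ⊎ (¬ z ≡ q × adj G z q ≡ false)))
    NonadjacentAttachments : ℕ → Set
    NonadjacentAttachments i = Σ ℕ λ D → D < L × ((0 < i × suc i + D < L) ×
      Σ (Vertex G) λ z → Σ (Vertex G) λ z' → inK K z ≡ true × (inK K z' ≡ true ×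
        (adj G (c i) z ≡ true × (adj G (c (suc i + D)) z' ≡ true × (¬ z ≡ z' × adj G z z' ≡ false)))))
    repetition-or-chord? : Dec (Σ ℕ λ i → i < L × RepetitionOrChord i)
    repetition-or-chord? = NP.anyUpTo? (λ i → NP.anyUpTo? (λ D →
      (suc i + D ≤? L) ×-dec ((c i ≟ c (suc i + D)) ⊎-dec ((0 <? D) ×-dec (adj G (c i) (c (suc i + D)) BP.≟ true))))
      (suc L)) L
    bad-attachment? : Dec (Σ ℕ λ i → i < L × BadAttachment i)
    bad-attachment? = NP.anyUpTo? (λ i → (0 <? i) ×-dec FP.any? (λ z →
      (inK K z BP.≟ true) ×-dec ((adj G (c i) z BP.≟ true) ×-dec
        ((¬? (z ≟ p) ×-dec (adj G z p BP.≟ false)) ⊎-dec (¬? (z ≟ q) ×-dec (adj G z q BP.≟ false)))))) L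
    nonadjacent-attachments? : Dec (Σ ℕ λ i → i < L × NonadjacentAttachments i)
    nonadjacent-attachments? = NP.anyUpTo? (λ i → NP.anyUpTo? (λ D →
      ((0 <? i) ×-dec (suc i + D <? L)) ×-dec FP.any? (λ z → FP.any? (λ z' →
        (inK K z BP.≟ true) ×-dec ((inK K z' BP.≟ true) ×-dec ((adj G (c i) z BP.≟ true) ×-dec
          ((adj G (c (suc i + D)) z' BP.≟ true) ×-dec (¬? (z ≟ z') ×-dec (adj G z z' BP.≟ false))))))))
      L) L
    bounds : ∀ i D → suc i + D ≤ L → i < L × D < suc L
    bounds i D h = ≤-trans (NP.m≤m+n (suc i) D) h , s≤s (NP.m+n≤o⇒n≤o (suc i) h)
    bounds′ : ∀ i D → suc i + D < L → i < L × D < L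
    bounds′ i D h = proj₁ (bounds i D (NP.<⇒≤ h)) , ≤-trans (s≤s (NP.m≤n+m D (suc i))) h
    clean-case : ¬ (Σ ℕ λ i → i < L × RepetitionOrChord i) → ¬ (Σ ℕ λ i → i < L × BadAttachment i) →
                 ¬ (Σ ℕ λ i → i < L × NonadjacentAttachments i) → ⊥
    shorten : ⊥
    shorten with repetition-or-chord?
    ... | yes (i , iL , D , DL , h , inj₁ eq) = repetition
      where
      j = suc i + D
      repetition : ⊥
      repetition with j NP.≟ L
      ... | yes jL = shorter (≤-trans (NP.m≤m+n (suc i) D) h)
                  (sub-linkage w 0 i (subst (_≤ L) (≡sym (NP.+-identityʳ i)) (NP.<⇒≤ iL)) p q pK qK pq npq c0
                    (subst (λ t → adj G (c t) q ≡ true) (≡sym (NP.+-identityʳ i))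
                      (subst (λ x → adj G x q ≡ true) (≡sym eq) (subst (λ t → adj G (c t) q ≡ true) (≡sym jL) cL))))
      ... | no jL = shorter (+suc≡⇒< eL') (shortcut-linkage w i D (L ∸ suc D) eL' hj ch)
        where
        jl : j < L
        jl = NP.≤∧≢⇒< h jL
        hj : suc i + suc D ≤ L
        hj = subst (_≤ L) (≡sym (cong suc (NP.+-suc i D))) jl
        eL' : (L ∸ suc D) + suc D ≡ L
        eL' = NP.m∸n+n≡m (NP.m+n≤o⇒n≤o (suc i) hj)
        ch : adj G (c i) (c (suc i + suc D)) ≡ true
        ch = subst (λ t → adj G (c i) (c t) ≡ true) (≡sym (cong suc (NP.+-suc i D)))
               (subst (λ x → adj G x (c (suc j)) ≡ true) (≡sym eq) (stp j jl))
    ... | yes (i , iL , zero , DL , h , inj₂ (() , _))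
    ... | yes (i , iL , suc d , DL , h , inj₂ (_ , ch)) = shorter (+suc≡⇒< eL') (shortcut-linkage w i d (L ∸ suc d) eL' h ch)
      where
      eL' : (L ∸ suc d) + suc d ≡ L
      eL' = NP.m∸n+n≡m (NP.m+n≤o⇒n≤o (suc i) h)
    ... | no ¬repetition-or-chord with bad-attachment?
    ... | yes (i , iL , ip , z , zK , a , inj₁ (zp , nzp)) =
          shorter iL (sub-linkage w 0 i (subst (_≤ L) (≡sym (NP.+-identityʳ i)) (NP.<⇒≤ iL)) p z pK zK
                       (λ e → zp (≡sym e)) (trans (Graph.sym G p z) nzp) c0
                   (subst (λ t → adj G (c t) z ≡ true) (≡sym (NP.+-identityʳ i)) a))
    ... | yes (suc i , iL , ip , z , zK , a , inj₂ (zq , nzq)) =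
          shorter (+suc≡⇒< eL') (sub-linkage w (suc i) (L ∸ suc i) (subst (_≤ L) (≡sym eL') ≤-refl) z q zK qK zq nzq a
                   (subst (λ t → adj G (c t) q ≡ true) (≡sym eL') cL))
      where
      eL' : (L ∸ suc i) + suc i ≡ L
      eL' = NP.m∸n+n≡m (NP.<⇒≤ iL)
    ... | no ¬bad-attachment with nonadjacent-attachments?
    ... | yes (suc i , iL , D , DL , (ip , jL) , z , z' , zK , z'K , a , a' , zz , nzz) =
          shorter (≤-trans (m<m+suc (suc D) i) h'') (sub-linkage w (suc i) (suc D) h'' z z' zK z'K zz nzz a
                (subst (λ t → adj G (c t) z' ≡ true) (cong suc (≡sym e)) a'))
      where
      e : D + suc i ≡ suc i + D
      e = NP.+-comm D (suc i)
      h'' : suc D + suc i ≤ L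
      h'' = subst (_≤ L) (cong suc (≡sym e)) (NP.<⇒≤ jL)
    ... | no ¬nonadjacent-attachments = clean-case ¬repetition-or-chord ¬bad-attachment ¬nonadjacent-attachments
    clean-case ¬repetition-or-chord ¬bad-attachment ¬nonadjacent-attachments = side (∨-elim (inA p) _ pK)
      where
      noRep : ∀ i D → suc i + D ≤ L → ¬ c i ≡ c (suc i + D)
      noRep i D h eq = ¬repetition-or-chord (i , proj₁ (bounds i D h) , D , proj₂ (bounds i D h) , h , inj₁ eq)
      noCh : ∀ i d → suc i + suc d ≤ L → adj G (c i) (c (suc i + suc d)) ≡ false
      noCh i d h = BP.¬-not λ a →
        ¬repetition-or-chord (i , proj₁ (bounds i (suc d) h) , suc d , proj₂ (bounds i (suc d) h) , h , inj₂ (s≤s z≤n , a))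
      attOK : ∀ i → 0 < i → i < L → ∀ z → inK K z ≡ true → adj G (c i) z ≡ true →
              adj G z p ≡ true × adj G z q ≡ true
      attOK i h1 h2 z zK a = ap , aq
        where
        ap : adj G z p ≡ true
        ap with adj G z p in e
        ... | true = refl
        ... | false with z ≟ p
        ...   | no zp = ⊥-elim (¬bad-attachment (i , h2 , h1 , z , zK , a , inj₁ (zp , e)))
        ...   | yes refl = ⊥-elim (¬bad-attachment (i , h2 , h1 , z , zK , a , inj₂ (pq , npq)))
        aq : adj G z q ≡ true
        aq with adj G z q in e
        ... | true = refl
        ... | false with z ≟ q
        ...   | no zq = ⊥-elim (¬bad-attachment (i , h2 , h1 , z , zK , a , inj₂ (zq , e)))
        ...   | yes refl = ⊥-elim (¬bad-attachment (i , h2 , h1 , z , zK , a , inj₁ ((λ e' → pq (≡sym e')) , trans (Graph.sym G q p) npq)))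
      attU : ∀ i D → 0 < i → suc i + D < L → ∀ z z' → inK K z ≡ true → inK K z' ≡ true → adj G (c i) z ≡ true →
           adj G (c (suc i + D)) z' ≡ true → z ≡ z' ⊎ adj G z z' ≡ true
      attU i D h1 h2 z z' zK z'K a a' with z ≟ z'
      ... | yes e = inj₁ e
      ... | no zz with adj G z z' in e
      ...   | true = inj₂ refl
      ...   | false = ⊥-elim (¬nonadjacent-attachments
                          (i , proj₁ (bounds′ i D h2) , D , proj₂ (bounds′ i D h2) , (h1 , h2) , z , z' , zK , z'K , a , a' , zz , e))
      side : inA p ≡ true ⊎ inB p ≡ true → ⊥
      side (inj₁ pA) = induced-linkage-impossible K mx tfG ifG L c p q out stp pK qK pq npq c0 cL pA noRep noCh attOK attU
      side (inj₂ pB) = induced-linkage-impossible (swap K) (Maximal-swap K mx) tfG ifG L c p q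
                        (λ i h → trans (inK-swap K (c i)) (out i h)) stp
                        (trans (inK-swap K p) pK) (trans (inK-swap K q) qK) pq npq c0 cL pB noRep noCh
                        (λ i h1 h2 z zK a → attOK i h1 h2 z (trans (≡sym (inK-swap K z)) zK) a)
                          (λ i D h1 h2 z z' zK z'K a a' →
                             attU i D h1 h2 z z' (trans (≡sym (inK-swap K z)) zK) (trans (≡sym (inK-swap K z')) z'K) a a')

  no-linkage : ∀ {L} → Linkage L → ⊥
  no-linkage {L} = no-linkage′ (suc L) L ≤-refl

cons : ∀ {m n} → Fin n → (Fin m → Fin n) → Fin (suc m) → Fin n
cons x g zero = x
cons x g (suc i) = g i

∃-function? : ∀ m {n} (P : (Fin m → Fin n) → Set) → (∀ f g → (∀ i → f i ≡ g i) → P f → P g) →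
              (∀ f → Dec (P f)) → Dec (Σ _ P)
∃-function? zero P resp d with d (λ ())
... | yes p = yes (_ , p)
... | no np = no λ { (f , pf) → np (resp f (λ ()) (λ ()) pf) }
∃-function? (suc m) {n} P resp d
  with FP.any? (λ x → ∃-function? m (λ g → P (cons x g))
                         (λ f g h → resp _ _ (λ { zero → refl ; (suc i) → h i })) (λ g → d (cons x g)))
... | yes (x , g , p) = yes (cons x g , p)
... | no np = no λ { (f , pf) → np (f zero , (λ i → f (suc i)) , resp f _ (λ { zero → refl ; (suc i) → refl }) pf) }

abstract
  contains? : (G H : Graph) → Dec (Contains G H)
  contains? G H with ∃-function? (size H) (λ f → (∀ x y → f x ≡ f y → x ≡ y) × (∀ u v → adj G (f u) (f v) ≡ adj H u v))
         (λ f g h (i , a) → (λ x y e → i x y (trans (h x) (trans e (≡sym (h y))))) ,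
                            (λ u v → trans (cong₂ (adj G) (≡sym (h u)) (≡sym (h v))) (a u v)))
         (λ f → FP.all? (λ x → FP.all? (λ y → (f x ≟ f y) →-dec (x ≟ y))) ×-dec
                FP.all? (λ u → FP.all? (λ v → adj G (f u) (f v) BP.≟ adj H u v)))
  ... | yes (f , i , a) = yes (f , (λ {x} {y} e → i x y e) , a)
  ... | no n = no λ { (f , i , a) → n (f , (λ x y e → i e) , a) }

abstract
  permutation-sending-pair : ∀ (a b a' b' : Fin 3) → ¬ a ≡ b → ¬ a' ≡ b' →
    Σ (Fin 3 → Fin 3) λ π → ((∀ x y → π x ≡ π y → x ≡ y) × (π a ≡ a' × π b ≡ b'))
  permutation-sending-pair = from-yes (FP.all? λ a → FP.all? λ b → FP.all? λ a' → FP.all? λ b' → ¬? (a ≟ b) →-dec (¬? (a' ≟ b') →-dec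
             ∃-function? 3 {3} (λ π → (∀ x y → π x ≡ π y → x ≡ y) × (π a ≡ a' × π b ≡ b'))
               (λ f g h (i , e1 , e2) → (λ x y e → i x y (trans (h x) (trans e (≡sym (h y))))) ,
                                        trans (≡sym (h a)) e1 , trans (≡sym (h b)) e2)
               (λ π → FP.all? (λ x → FP.all? (λ y → (π x ≟ π y) →-dec (x ≟ y))) ×-dec ((π a ≟ a') ×-dec (π b ≟ b')))))

  permutation-sending : ∀ (a a' : Fin 3) → Σ (Fin 3 → Fin 3) λ π → ((∀ x y → π x ≡ π y → x ≡ y) × π a ≡ a')
  permutation-sending = from-yes (FP.all? λ a → FP.all? λ a' →
             ∃-function? 3 {3} (λ π → (∀ x y → π x ≡ π y → x ≡ y) × π a ≡ a')
               (λ f g h (i , e1) → (λ x y e → i x y (trans (h x) (trans e (≡sym (h y))))) , trans (≡sym (h a)) e1)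
               (λ π → FP.all? (λ x → FP.all? (λ y → (π x ≟ π y) →-dec (x ≟ y))) ×-dec (π a ≟ a')))

sideA : Fin 3 → Fin 6
sideA zero = zero
sideA (suc zero) = suc zero
sideA (suc (suc zero)) = suc (suc zero)

sideB : Fin 3 → Fin 6
sideB zero = suc (suc (suc zero))
sideB (suc zero) = suc (suc (suc (suc zero)))
sideB (suc (suc zero)) = suc (suc (suc (suc (suc zero))))

abstract
  K33-AA : ∀ i j → adj K33 (sideA i) (sideA j) ≡ false
  K33-AA = from-yes (FP.all? λ i → FP.all? λ j → adj K33 (sideA i) (sideA j) BP.≟ false)
  K33-BB : ∀ i j → adj K33 (sideB i) (sideB j) ≡ false
  K33-BB = from-yes (FP.all? λ i → FP.all? λ j → adj K33 (sideB i) (sideB j) BP.≟ false)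
  K33-AB : ∀ i j → adj K33 (sideA i) (sideB j) ≡ true
  K33-AB = from-yes (FP.all? λ i → FP.all? λ j → adj K33 (sideA i) (sideB j) BP.≟ true)
  sideA≢sideB : ∀ i j → ¬ sideA i ≡ sideB j
  sideA≢sideB = from-yes (FP.all? λ i → FP.all? λ j → ¬? (sideA i ≟ sideB j))

abstract
  K33⇒Biclique : (G : Graph) → Contains G K33 → Biclique G
  K33⇒Biclique G (f , fi , fa) = record
    { inA = inA ; inB = inB ; A⇒¬B = A⇒¬B
    ; A-independent = A-independent ; B-independent = B-independent ; A-complete-B = A-complete-B
    ; a1 = f (sideA zero) ; a2 = f (sideA (suc zero)) ; a3 = f (sideA (suc (suc zero)))
    ; b1 = f (sideB zero) ; b2 = f (sideB (suc zero)) ; b3 = f (sideB (suc (suc zero)))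
    ; a1A = mA zero ; a2A = mA (suc zero) ; a3A = mA (suc (suc zero))
    ; b1B = mB zero ; b2B = mB (suc zero) ; b3B = mB (suc (suc zero))
    ; a12 = (λ ()) ∘ fi ; a13 = (λ ()) ∘ fi ; a23 = (λ ()) ∘ fi
    ; b12 = (λ ()) ∘ fi ; b13 = (λ ()) ∘ fi ; b23 = (λ ()) ∘ fi }
    where
    inA : Vertex G → Bool
    inA v = ⌊ FP.any? (λ i → v ≟ f (sideA i)) ⌋
    inB : Vertex G → Bool
    inB v = ⌊ FP.any? (λ i → v ≟ f (sideB i)) ⌋
    mA : ∀ i → inA (f (sideA i)) ≡ true
    mA i = ⇒⌊⌋ (FP.any? (λ j → f (sideA i) ≟ f (sideA j))) (i , refl)
    mB : ∀ i → inB (f (sideB i)) ≡ true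
    mB i = ⇒⌊⌋ (FP.any? (λ j → f (sideB i) ≟ f (sideB j))) (i , refl)
    wA : ∀ v → inA v ≡ true → Σ (Fin 3) λ i → v ≡ f (sideA i)
    wA v h = ⌊⌋⇒ (FP.any? (λ i → v ≟ f (sideA i))) h
    wB : ∀ v → inB v ≡ true → Σ (Fin 3) λ i → v ≡ f (sideB i)
    wB v h = ⌊⌋⇒ (FP.any? (λ i → v ≟ f (sideB i))) h
    A⇒¬B : ∀ v → inA v ≡ true → inB v ≡ false
    A⇒¬B v h = BP.¬-not λ h′ →
      sideA≢sideB (proj₁ (wA v h)) (proj₁ (wB v h′)) (fi (trans (≡sym (proj₂ (wA v h))) (proj₂ (wB v h′))))
    A-independent : ∀ u v → inA u ≡ true → inA v ≡ true → adj G u v ≡ false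
    A-independent u v hu hv with wA u hu | wA v hv
    ... | i , refl | j , refl = trans (fa (sideA i) (sideA j)) (K33-AA i j)
    B-independent : ∀ u v → inB u ≡ true → inB v ≡ true → adj G u v ≡ false
    B-independent u v hu hv with wB u hu | wB v hv
    ... | i , refl | j , refl = trans (fa (sideB i) (sideB j)) (K33-BB i j)
    A-complete-B : ∀ u v → inA u ≡ true → inB v ≡ true → adj G u v ≡ true
    A-complete-B u v hu hv with wA u hu | wB v hv
    ... | i , refl | j , refl = trans (fa (sideA i) (sideB j)) (K33-AB i j)

free-colour : (G : Graph) (v : Vertex G) (c : Vertex G → Fin 3) → degree G v ≤ 2 →
              Σ (Fin 3) λ k → ∀ w → adj G v w ≡ true → ¬ c w ≡ k
free-colour G v c dv with FP.any? (λ k → FP.all? (λ w → (adj G v w BP.≟ true) →-dec ¬? (c w ≟ k)))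
... | yes free = free
... | no all-used = ⊥-elim (NP.<⇒≱ (s≤s dv) (subst (3 ≤_) (≡sym (degree≡count G v))
        (count≥3 (adj G v) (w zero) (w one) (w two)
          (distinct (λ ())) (distinct (λ ())) (distinct (λ ()))
          (w-adj zero) (w-adj one) (w-adj two))))
  where
  one two : Fin 3
  one = suc zero
  two = suc (suc zero)
  neighbour-coloured : ∀ k → Σ (Vertex G) λ w → adj G v w ≡ true × c w ≡ k
  neighbour-coloured k
    with FP.¬∀⟶∃¬ _ _ (λ w → (adj G v w BP.≟ true) →-dec ¬? (c w ≟ k)) (λ h → all-used (k , h))
  ... | w , ¬free with adj G v w BP.≟ true | c w ≟ k
  ... | yes a | yes e = w , a , e
  ... | yes a | no ne = ⊥-elim (¬free (λ _ → ne))
  ... | no na | _ = ⊥-elim (¬free (⊥-elim ∘ na))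
  w : Fin 3 → Vertex G
  w k = proj₁ (neighbour-coloured k)
  w-adj : ∀ k → adj G v (w k) ≡ true
  w-adj k = proj₁ (proj₂ (neighbour-coloured k))
  distinct : ∀ {k l} → ¬ k ≡ l → ¬ w k ≡ w l
  distinct {k} {l} k≢l e = k≢l (trans (≡sym (proj₂ (proj₂ (neighbour-coloured k))))
                                      (trans (cong c e) (proj₂ (proj₂ (neighbour-coloured l)))))

extend-colouring-low-degree : (G : Graph) (v : Vertex G) → degree G v ≤ 2 →
  ThreeColorable (induced G (λ w → not ⌊ w ≟ v ⌋)) → ThreeColorable G
extend-colouring-low-degree G v dv c-v with lift-colouring G (λ w → not ⌊ w ≟ v ⌋) c-v
... | c , c-proper with free-colour G v c dv
... | k , k-free = c′ , c′-proper
  where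
  colourAt : ∀ w → Dec (w ≡ v) → Fin 3
  colourAt w (yes _) = k
  colourAt w (no _) = c w
  c′ : Vertex G → Fin 3
  c′ w = colourAt w (w ≟ v)
  ≢v : ∀ w → ¬ w ≡ v → not ⌊ w ≟ v ⌋ ≡ true
  ≢v w w≢v = cong not (BP.¬-not (w≢v ∘ ⌊≟⌋⇒≡))
  c′-proper : ∀ x y → adj G x y ≡ true → ¬ c′ x ≡ c′ y
  c′-proper x y xy with x ≟ v | y ≟ v
  ... | yes refl | yes refl = λ _ → adj⇒≢ G xy refl
  ... | yes refl | no _ = λ e → k-free y xy (≡sym e)
  ... | no _ | yes refl = λ e → k-free x (adj-sym G xy) e
  ... | no x≢v | no y≢v = c-proper x y (≢v x x≢v) (≢v y y≢v) xy

colour-empty : (G : Graph) → size G ≡ 0 → ThreeColorable G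
colour-empty G empty = (λ v → ⊥-elim (no-vertex v)) , λ u v _ → ⊥-elim (no-vertex u)
  where
  no-vertex : Vertex G → ⊥
  no-vertex v with subst Fin empty v
  ... | ()

colour-spanning-biclique : ∀ {G} (K : Biclique G) → (∀ v → inK K v ≡ true) → ThreeColorable G
colour-spanning-biclique {G} K spanning = c , c-proper
  where
  open Biclique K
  c : Vertex G → Fin 3
  c v = if inA v then zero else suc zero
  ¬A⇒B : ∀ w → inA w ≡ false → inB w ≡ true
  ¬A⇒B w e with spanning w
  ... | h rewrite e = h
  c-proper : ∀ x y → adj G x y ≡ true → ¬ c x ≡ c y
  c-proper x y xy with inA x in Ax | inA y in Ay
  ... | true | true = λ _ → true⇒¬false xy (A-independent x y Ax Ay)
  ... | true | false = λ ()
  ... | false | true = λ ()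
  ... | false | false = λ _ → true⇒¬false xy (B-independent x y (¬A⇒B x Ax) (¬A⇒B y Ay))

module _ {G : Graph} (K : Biclique G) where

  record Walk (x y : Vertex G) : Set where
    field
      L : ℕ
      c : ℕ → Vertex G
      cx : c 0 ≡ x
      cy : c L ≡ y
      out : ∀ i → i ≤ L → inK K (c i) ≡ false
      stp : ∀ i → i < L → adj G (c i) (c (suc i)) ≡ true

  walk-refl : ∀ x → inK K x ≡ false → Walk x x
  walk-refl x o = record { L = 0 ; c = λ _ → x ; cx = refl ; cy = refl ; out = λ _ _ → o ; stp = λ i () }

  walk-prepend : ∀ w x y → inK K w ≡ false → adj G w x ≡ true → Walk x y → Walk w y
  walk-prepend w x y o a wk = record { L = suc L ; c = c' ; cx = refl ; cy = cy ; out = out' ; stp = stp' }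
    where
    open Walk wk
    c' : ℕ → Vertex G
    c' zero = w
    c' (suc t) = c t
    out' : ∀ i → i ≤ suc L → inK K (c' i) ≡ false
    out' zero _ = o
    out' (suc i) (s≤s h) = out i h
    stp' : ∀ i → i < suc L → adj G (c' i) (c' (suc i)) ≡ true
    stp' zero _ = subst (λ t → adj G w t ≡ true) (≡sym cx) a
    stp' (suc i) (s≤s h) = stp i h

  walk-append : ∀ y x w → inK K w ≡ false → adj G x w ≡ true → Walk y x → Walk y w
  walk-append y x w o a wk = record
    { L = suc L ; c = c' ; cx = trans (cle 0 z≤n) cx ; cy = cgt (suc L) (NP.<-irrefl refl) ; out = out' ; stp = stp' }
    where
    open Walk wk
    pk : ∀ t → Dec (t ≤ L) → Vertex G
    pk t (yes _) = c t
    pk t (no _) = w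
    c' : ℕ → Vertex G
    c' t = pk t (t ≤? L)
    cle : ∀ t → t ≤ L → c' t ≡ c t
    cle t h with t ≤? L
    ... | yes _ = refl
    ... | no n = ⊥-elim (n h)
    cgt : ∀ t → ¬ t ≤ L → c' t ≡ w
    cgt t h with t ≤? L
    ... | yes y = ⊥-elim (h y)
    ... | no _ = refl
    out' : ∀ i → i ≤ suc L → inK K (c' i) ≡ false
    out' i h with i ≤? L
    ... | yes y = out i y
    ... | no _ = o
    stp' : ∀ i → i < suc L → adj G (c' i) (c' (suc i)) ≡ true
    stp' i (s≤s h) with NP.m≤n⇒m<n∨m≡n h
    ... | inj₁ lt rewrite cle i h | cle (suc i) lt = stp i lt
    ... | inj₂ refl rewrite cle i h | cgt (suc i) (NP.<-irrefl refl) = subst (λ t → adj G t w ≡ true) (≡sym cy) a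

  record Component (u : Vertex G) (X : Vertex G → Bool) : Set where
    field
      u∈X : X u ≡ true
      X-outside : ∀ x → X x ≡ true → inK K x ≡ false
      X-connected : ∀ x y → X x ≡ true → X y ≡ true → Walk x y

  Closed : (Vertex G → Bool) → Set
  Closed X = ∀ x w → X x ≡ true → inK K w ≡ false → adj G x w ≡ true → X w ≡ true

  grow : ∀ u X (w x : Vertex G) → Component u X → X w ≡ false → inK K w ≡ false → X x ≡ true → adj G x w ≡ true →
         Component u (λ z → X z ∨ ⌊ z ≟ w ⌋)
  grow u X w x C Xw0 wo Xx a = record { u∈X = ∨-introˡ _ u∈X ; X-outside = X-outside′ ; X-connected = X-connected′ }
    where
    open Component C
    X-outside′ : ∀ z → (X z ∨ ⌊ z ≟ w ⌋) ≡ true → inK K z ≡ false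
    X-outside′ z h with ∨-elim (X z) _ h
    ... | inj₁ h' = X-outside z h'
    ... | inj₂ e rewrite ⌊≟⌋⇒≡ {w = z} e = wo
    X-connected′ : ∀ y y' → (X y ∨ ⌊ y ≟ w ⌋) ≡ true → (X y' ∨ ⌊ y' ≟ w ⌋) ≡ true → Walk y y'
    X-connected′ y y' h h' with ∨-elim (X y) _ h | ∨-elim (X y') _ h'
    ... | inj₁ a1 | inj₁ a2 = X-connected y y' a1 a2
    ... | inj₁ a1 | inj₂ e2 rewrite ⌊≟⌋⇒≡ {w = y'} e2 = walk-append y x w wo a (X-connected y x a1 Xx)
    ... | inj₂ e1 | inj₁ a2 rewrite ⌊≟⌋⇒≡ {w = y} e1 = walk-prepend w x y' wo (trans (Graph.sym G w x) a) (X-connected x y' Xx a2)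
    ... | inj₂ e1 | inj₂ e2 rewrite ⌊≟⌋⇒≡ {w = y} e1 | ⌊≟⌋⇒≡ {w = y'} e2 = walk-refl w wo

  abstract
    closed-component : ∀ u fuel X → Component u X → count (λ z → not (X z)) < fuel →
                       Σ (Vertex G → Bool) λ X' → Component u X' × Closed X'
    closed-component u zero X C ()
    closed-component u (suc fuel) X C (s≤s lt)
      with FP.any? (λ w → (X w BP.≟ false) ×-dec ((inK K w BP.≟ false) ×-dec
                            FP.any? (λ x → (X x BP.≟ true) ×-dec (adj G x w BP.≟ true))))
    ... | yes (w , Xw0 , wo , x , Xx , a) =
      closed-component u fuel _ (grow u X w x C Xw0 wo Xx a) (≤-trans (count-¬∪-< X w Xw0) lt)
    ... | no n = X , C , λ x w Xx wo a → cl x w Xx wo a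
      where
      cl : ∀ x w → X x ≡ true → inK K w ≡ false → adj G x w ≡ true → X w ≡ true
      cl x w Xx wo a with X w in e
      ... | true = refl
      ... | false = ⊥-elim (n (w , e , wo , x , Xx , a))

  component : ∀ u → inK K u ≡ false → Σ (Vertex G → Bool) λ X → Component u X × Closed X
  component u u-out = closed-component u (suc (count (not ∘ X₀))) X₀ singleton ≤-refl
    where
    X₀ : Vertex G → Bool
    X₀ z = ⌊ z ≟ u ⌋
    singleton : Component u X₀
    singleton = record
      { u∈X = ⌊≟⌋-refl u
      ; X-outside = λ x h → subst (λ t → inK K t ≡ false) (≡sym (⌊≟⌋⇒≡ h)) u-out
      ; X-connected = λ x y hx hy → subst₂ Walk (≡sym (⌊≟⌋⇒≡ hx)) (≡sym (⌊≟⌋⇒≡ hy)) (walk-refl u u-out) }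

Clique : (G : Graph) → (Vertex G → Bool) → Set
Clique G S = ∀ s s′ → S s ≡ true → S s′ ≡ true → ¬ s ≡ s′ → adj G s s′ ≡ true

ProperOn-⊆ : ∀ (G : Graph) {P Q : Vertex G → Bool} {c : Vertex G → Fin 3} →
             (∀ v → P v ≡ true → Q v ≡ true) → ProperOn G Q c → ProperOn G P c
ProperOn-⊆ G P⊆Q c-proper u v pu pv = c-proper u v (P⊆Q u pu) (P⊆Q v pv)

-- A clique of a triangle-free graph has at most two vertices, and on at most two vertices any
-- two proper colourings differ by a permutation of the colours.
align-on-clique : (G : Graph) → TriangleFree G → (S : Vertex G → Bool) → Clique G S →
  (c₁ c₂ : Vertex G → Fin 3) → ProperOn G S c₁ → ProperOn G S c₂ →
  Σ (Fin 3 → Fin 3) λ π → (∀ x y → π x ≡ π y → x ≡ y) × (∀ s → S s ≡ true → π (c₁ s) ≡ c₂ s)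
align-on-clique G tfG S S-clique c₁ c₂ c₁-proper c₂-proper with FP.any? (λ s → S s BP.≟ true)
... | no empty = id , (λ x y e → e) , λ s h → ⊥-elim (empty (s , h))
... | yes (s , hs) with FP.any? (λ s′ → (S s′ BP.≟ true) ×-dec ¬? (s′ ≟ s))
...   | no only-s with permutation-sending (c₁ s) (c₂ s)
...     | π , π-inj , πs = π , π-inj , aligned
  where
  aligned : ∀ t → S t ≡ true → π (c₁ t) ≡ c₂ t
  aligned t ht with t ≟ s
  ... | yes refl = πs
  ... | no t≢s = ⊥-elim (only-s (t , ht , t≢s))
align-on-clique G tfG S S-clique c₁ c₂ c₁-proper c₂-proper | yes (s , hs) | yes (s′ , hs′ , s′≢s)
  with permutation-sending-pair (c₁ s) (c₁ s′) (c₂ s) (c₂ s′)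
         (c₁-proper s s′ hs hs′ ss′) (c₂-proper s s′ hs hs′ ss′)
  where
  ss′ : adj G s s′ ≡ true
  ss′ = S-clique s s′ hs hs′ (s′≢s ∘ ≡sym)
... | π , π-inj , πs , πs′ = π , π-inj , aligned
  where
  aligned : ∀ t → S t ≡ true → π (c₁ t) ≡ c₂ t
  aligned t ht with t ≟ s | t ≟ s′
  ... | yes refl | _ = πs
  ... | no _ | yes refl = πs′
  ... | no t≢s | no t≢s′ = ⊥-elim (tfG (triangle G s s′ t
          (S-clique s s′ hs hs′ (s′≢s ∘ ≡sym)) (S-clique s′ t hs′ ht (t≢s′ ∘ ≡sym)) (S-clique s t hs ht (t≢s ∘ ≡sym))))

glue-colourings : (G : Graph) (X S : Vertex G → Bool) (c₁ c₂ : Vertex G → Fin 3) (π : Fin 3 → Fin 3) →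
  (∀ x y → π x ≡ π y → x ≡ y) → (∀ s → S s ≡ true → π (c₁ s) ≡ c₂ s) →
  ProperOn G (λ v → X v ∨ S v) c₁ → ProperOn G (not ∘ X) c₂ →
  (∀ x y → X x ≡ true → X y ≡ false → adj G x y ≡ true → S y ≡ true) →
  ThreeColorable G
glue-colourings G X S c₁ c₂ π π-inj aligned c₁-proper c₂-proper X-boundary = c , c-proper
  where
  colourAt : Vertex G → Bool → Fin 3
  colourAt v true = π (c₁ v)
  colourAt v false = c₂ v
  c : Vertex G → Fin 3
  c v = colourAt v (X v)
  c-proper : ∀ x y → adj G x y ≡ true → ¬ c x ≡ c y
  c-proper x y xy with X x in Xx | X y in Xy
  ... | true | true = c₁-proper x y (∨-introˡ _ Xx) (∨-introˡ _ Xy) xy ∘ π-inj _ _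
  ... | false | false = c₂-proper x y (cong not Xx) (cong not Xy) xy
  ... | true | false = λ e → c₁-proper x y (∨-introˡ _ Xx) (∨-introʳ (X y) Sy) xy
                                (π-inj _ _ (trans e (≡sym (aligned y Sy))))
    where Sy = X-boundary x y Xx Xy xy
  ... | false | true = λ e → c₁-proper x y (∨-introʳ (X x) Sx) (∨-introˡ _ Xy) xy
                                 (π-inj _ _ (trans (aligned x Sx) e))
    where Sx = X-boundary y x Xy Xx (adj-sym G xy)

SmallerColourable : Graph → Set
SmallerColourable G = ∀ H → size H < size G → TriangleFree H → ISK4Free H → ThreeColorable H

colour-induced : (G : Graph) → SmallerColourable G → TriangleFree G → ISK4Free G →
                 (P : Vertex G → Bool) (v : Vertex G) → P v ≡ false → ThreeColorable (induced G P)
colour-induced G IH tfG ifG P v pv =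
  IH (induced G P) (induced-smaller G P v pv) (TriangleFree-induced G P tfG) (ISK4Free-induced G P ifG)

module _ {G : Graph} (K : Biclique G) (mx : Maximal K) (tfG : TriangleFree G) (ifG : ISK4Free G) where
  open Biclique K

  attachments : (Vertex G → Bool) → Vertex G → Bool
  attachments X v = inK K v ∧ ⌊ FP.any? (λ x → (X x BP.≟ true) ×-dec (adj G x v BP.≟ true)) ⌋

  module _ {u : Vertex G} {X : Vertex G → Bool} (C : Component K u X) (X-closed : Closed K X) where
    open Component C

    attachment-inK : ∀ v → attachments X v ≡ true → inK K v ≡ true
    attachment-inK v h with inK K v
    ... | true = refl
    ... | false = h

    attachment-neighbour : ∀ v → attachments X v ≡ true → Σ (Vertex G) λ x → X x ≡ true × adj G x v ≡ true
    attachment-neighbour v h with inK K v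
    ... | true = ⌊⌋⇒ (FP.any? (λ x → (X x BP.≟ true) ×-dec (adj G x v BP.≟ true))) h

    X-boundary : ∀ x y → X x ≡ true → X y ≡ false → adj G x y ≡ true → attachments X y ≡ true
    X-boundary x y Xx Xy xy with inK K y in y∈K
    ... | false with () ← trans (≡sym (X-closed x y Xx y∈K xy)) Xy
    ... | true = ⇒⌊⌋ (FP.any? (λ x → (X x BP.≟ true) ×-dec (adj G x y BP.≟ true))) (x , Xx , xy)

    X-disjoint-K : ∀ v → inK K v ≡ true → X v ≡ false
    X-disjoint-K v v∈K = BP.¬-not λ h → true⇒¬false v∈K (X-outside v h)

    -- Two non-adjacent attachments would be joined through X by a linkage.
    attachments-clique : Clique G (attachments X)
    attachments-clique s s′ hs hs′ s≢s′ with adj G s s′ in ss′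
    ... | true = refl
    ... | false with attachment-neighbour s hs | attachment-neighbour s′ hs′
    ... | x , Xx , xs | x′ , Xx′ , x′s′ = ⊥-elim (no-linkage K mx tfG ifG linkage)
      where
      open Walk (X-connected x x′ Xx Xx′)
      linkage : Linkage K mx tfG ifG L
      linkage = record
        { c = c ; p = s ; q = s′ ; out = out ; stp = stp
        ; pK = attachment-inK s hs ; qK = attachment-inK s′ hs′ ; pq = s≢s′ ; npq = ss′
        ; c0 = subst (λ t → adj G t s ≡ true) (≡sym cx) xs
        ; cL = subst (λ t → adj G t s′ ≡ true) (≡sym cy) x′s′ }

    -- The vertices a1, a2 are non-adjacent, so they are not both attachments.
    missed-by-X∪S : Σ (Vertex G) λ a → (X a ∨ attachments X a) ≡ false
    missed-by-X∪S with attachments X a1 in S-a1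
    ... | false = a1 , ∨-false (X-disjoint-K a1 (∨-introˡ _ a1A)) S-a1
    ... | true with attachments X a2 in S-a2
    ...   | false = a2 , ∨-false (X-disjoint-K a2 (∨-introˡ _ a2A)) S-a2
    ...   | true = ⊥-elim (true⇒¬false (attachments-clique a1 a2 S-a1 S-a2 a12) (A-independent a1 a2 a1A a2A))

    colour-via-component : SmallerColourable G → ThreeColorable G
    colour-via-component IH =
      glue-colourings G X S c₁ c₂ π π-inj aligned c₁-proper c₂-proper X-boundary
      where
      S = attachments X
      X∪S = λ v → X v ∨ S v
      c₁c₁ = lift-colouring G X∪S (colour-induced G IH tfG ifG X∪S (proj₁ missed-by-X∪S) (proj₂ missed-by-X∪S))
      c₂c₂ = lift-colouring G (not ∘ X) (colour-induced G IH tfG ifG (not ∘ X) u (cong not u∈X))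
      c₁ = proj₁ c₁c₁
      c₁-proper = proj₂ c₁c₁
      c₂ = proj₁ c₂c₂
      c₂-proper = proj₂ c₂c₂
      Π = align-on-clique G tfG S attachments-clique c₁ c₂
            (ProperOn-⊆ G (λ v → ∨-introʳ (X v)) c₁-proper)
            (ProperOn-⊆ G (λ v h → cong not (X-disjoint-K v (attachment-inK v h))) c₂-proper)
      π = proj₁ Π
      π-inj = proj₁ (proj₂ Π)
      aligned = proj₂ (proj₂ Π)

  colour-with-maximal-biclique : SmallerColourable G → ThreeColorable G
  colour-with-maximal-biclique IH with FP.any? (λ u → inK K u BP.≟ false)
  ... | no nothing-outside = colour-spanning-biclique K (λ v → BP.¬-not (λ e → nothing-outside (v , e)))
  ... | yes (u , u-out) with component K u u-out
  ... | X , C , X-closed = colour-via-component C X-closed IH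

LowDegreeHypothesis : Set
LowDegreeHypothesis = ∀ (G : Graph) → size G ≥ 1 → ¬ Contains G Triangle → ¬ ContainsISK4 G →
  ¬ Contains G K33 → ∃[ v ] (degree G v ≤ 2)

three-colourable-step : LowDegreeHypothesis → (G : Graph) → SmallerColourable G →
                        TriangleFree G → ISK4Free G → ThreeColorable G
three-colourable-step hyp G IH tfG ifG with FP.any? (λ v → degree G v ≤? 2)
... | yes (v , dv) = extend-colouring-low-degree G v dv
                       (colour-induced G IH tfG ifG (λ w → not ⌊ w ≟ v ⌋) v (cong not (⌊≟⌋-refl v)))
... | no no-low-degree with size G NP.≟ 0
... | yes empty = colour-empty G empty
... | no nonempty with contains? G K33
... | no K33-free = ⊥-elim (no-low-degree (hyp G (NP.n≢0⇒n>0 nonempty) tfG ifG K33-free))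
... | yes K33⊆G with maximal-extension tfG (K33⇒Biclique G K33⊆G)
... | K , K-maximal = colour-with-maximal-biclique K K-maximal tfG ifG IH

theorem2p7 : (∀ (G : Graph) → size G ≥ 1 → ¬ Contains G Triangle → ¬ ContainsISK4 G →
    ¬ Contains G K33 → ∃[ v ] (degree G v ≤ 2)) →
    ∀ (G : Graph) → ¬ Contains G Triangle → ¬ ContainsISK4 G → ThreeColorable G
theorem2p7 hyp G = three-colourable (suc (size G)) G ≤-refl
  where
  three-colourable : ∀ n (G : Graph) → size G < n → TriangleFree G → ISK4Free G → ThreeColorable G
  three-colourable (suc n) G (s≤s G<n) =
    three-colourable-step hyp G (λ H H<G → three-colourable n H (≤-trans H<G G<n))
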